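{- For all integers $1\le r\le n$ and $d\ge2$, $$b_{n,d}(\Delta_{n-r})=\sum_{x}b_{n,d-1}(x),$$ where the sum ranges over all simple $n$-braids $x$ that are right divisible by $\Delta_{n-r}$.
   Context: For $n\ge1$, $B_n^+$ is the monoid generated by $\sigma_1,\dots,\sigma_{n-1}$ subject to $\sigma_i\sigma_j=\sigma_j\sigma_i$ for $|i-j|\ge 2$ and $\sigma_i\sigma_j\sigma_i=\sigma_j\sigma_i\sigma_j$ for $|i-j|=1$; $B_m^+\subseteq B_n^+$ for $m\le n$. $x$ is a left (resp. right) divisor of $y$ if $y=xz$ (resp. $y=zx$) for some $z\in B_n^+$. Define $\Delta_0=\Delta_1=1$, $\Delta_m=\sigma_1\cdots\sigma_{m-1}\Delta_{m-1}$. A positive $n$-braid is simple if it left-divides $\Delta_n$. A sequence $(x_1,\dots,x_d)$ of simple $n$-braids is normal if $x_k$ is the left gcd of $\Delta_n$ and $x_k\cdots x_d$ for each $k$. Every positive $n$-braid has a unique normal expression padded on the right by factors $1$; degree at most $d$ means all factors after the $d$th are $1$. $b_{n,d}(x)$ is the number of positive $n$-braids of degree at most $d$ whose $d$th normal factor is $x$, i.e. the number of normal sequences $(x_1,\dots,x_{d-1},x)$ of simple $n$-braids. -}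

module Defs where

open import Data.Nat using (ℕ; zero; suc; _+_; _≤_; _<_)
open import Data.Fin using (Fin)
open import Data.List using (List; []; _∷_; _++_; upTo; concat)
open import Data.List.Relation.Unary.All using (All)
open import Data.Vec using (Vec; toList; tabulate)
open import Data.Vec.Relation.Binary.Pointwise.Inductive using (Pointwise)
open import Data.Product using (Σ; _×_)
open import Data.Sum using (_⊎_)
open import Data.Unit using (⊤)
open import Relation.Binary.PropositionalEquality using (_≡_)

-- Braid words: the letter i : ℕ stands for the generator σ_(i+1).
BWord : Set
BWord = List ℕ

IsWord : ℕ → BWord → Set
IsWord n w = All (λ i → suc i < n) w

infix 4 _≈_
data _≈_ : BWord → BWord → Set where
  ≈-refl  : ∀ {u} → u ≈ u
  ≈-sym   : ∀ {u v} → u ≈ v → v ≈ u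
  ≈-trans : ∀ {u v w} → u ≈ v → v ≈ w → u ≈ w
  ≈-comm  : ∀ u v i j → (2 + i ≤ j ⊎ 2 + j ≤ i) →
            (u ++ i ∷ j ∷ v) ≈ (u ++ j ∷ i ∷ v)
  ≈-braid : ∀ u v i j → (suc i ≡ j ⊎ suc j ≡ i) →
            (u ++ i ∷ j ∷ i ∷ v) ≈ (u ++ j ∷ i ∷ j ∷ v)

-- Δ_0 = Δ_1 = 1, Δ_m = σ_1 ⋯ σ_(m-1) Δ_(m-1)
Δ : ℕ → BWord
Δ zero    = []
Δ (suc m) = upTo m ++ Δ m

LDiv : ℕ → BWord → BWord → Set
LDiv n x y = Σ BWord λ z → IsWord n z × (x ++ z ≈ y)

RDiv : ℕ → BWord → BWord → Set
RDiv n x y = Σ BWord λ z → IsWord n z × (z ++ x ≈ y)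

Simple : ℕ → BWord → Set
Simple n x = IsWord n x × LDiv n x (Δ n)

IsLGcd : ℕ → BWord → BWord → BWord → Set
IsLGcd n g a b =
  LDiv n g a × LDiv n g b ×
  (∀ c → IsWord n c → LDiv n c a → LDiv n c b → LDiv n c g)

Normal : ℕ → List BWord → Set
Normal n []       = ⊤
Normal n (x ∷ xs) = Simple n x × IsLGcd n x (Δ n) (concat (x ∷ xs)) × Normal n xs

IsEnum : {A : Set} → (A → A → Set) → (A → Set) → (k : ℕ) → (Fin k → A) → Set
IsEnum {A} _∼_ P k f =
  (∀ i → P (f i)) ×
  (∀ i j → f i ∼ f j → i ≡ j) ×
  (∀ a → P a → Σ (Fin k) λ i → f i ∼ a)

IsCount : {A : Set} → (A → A → Set) → (A → Set) → ℕ → Set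
IsCount {A} _∼_ P k = Σ (Fin k → A) λ f → IsEnum _∼_ P k f

-- b_{n,d}(x) = k : the number of normal sequences (x_1,…,x_(d-1),x) of simple
-- n-braids (sequences of braids, i.e. up to pointwise ≈) is k.  (For d ≥ 1.)
BCount : ℕ → ℕ → BWord → ℕ → Set
BCount n (suc e) x k =
  IsCount {Vec BWord e} (Pointwise _≈_) (λ xs → Normal n (toList xs ++ x ∷ [])) k
BCount n zero x k = ⊤ -- unused: b_{n,d} is only defined for d ≥ 1

{-# OPTIONS --safe #-}
module Submission where

-- For m ≤ n, a sequence (x₁, …, x_{d-1}, Δ_m) is normal iff (x₁, …, x_{d-1}) is normal and Δ_m
-- right-divides x_{d-1}; grouping the sequences counted by b_{n,d}(Δ_m) by their factor x_{d-1}
-- then gives the sum.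
--
-- For the equivalence: if y is the left gcd of Δ and y D, then gcd(Δ, a y D) = gcd(Δ, a y) for
-- every a, because Δ is quasi-central; so the earlier factors of a normal sequence do not see its
-- last factor. And a simple y is the gcd of Δ and y Δ_m iff Δ_m right-divides y: every letter σ_j
-- of Δ_m either right-divides y or makes y σ_j simple (which the gcd condition forbids), and Δ_m is
-- the right lcm of these letters; conversely, if Δ_m right-divides y and y σ_j were simple, then
-- Δ_m σ_j = σ_j′ Δ_m would put a square σ_j′ σ_j′ into a word for Δ.
--
-- This rests on the Garside theory of the positive braid monoid, derived from its presentation:
-- left cancellation and lcms, quasi-centrality of Δ, and simple braids as the reduced words of
-- permutations (exchange lemma, Matsumoto's theorem).

open import Defs
open import Data.Fin using (Fin; zero; suc; splitAt; join)
import Data.Fin.Properties as Fin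
open import Data.Fin.Properties using (splitAt-join; join-splitAt)
open import Data.List
  using (List; []; _∷_; _++_; [_]; length; reverse; concat; concatMap; map; lookup; upTo; downFrom; applyUpTo; initLast; _∷ʳ′_)
open import Data.List.Properties
  using ( ++-assoc; ++-identityʳ; length-++; length-++-sucʳ; length-upTo; length-reverse; concat-++; map-upTo
        ; reverse-++; reverse-involutive; reverse-upTo; unfold-reverse; upTo-∷ʳ)
open import Data.List.Membership.Propositional using (_∈_)
open import Data.List.Membership.Propositional.Properties using (∈-lookup; ∈-map⁺; ∈-concatMap⁺; ∈-upTo⁺)
open import Data.List.Relation.Binary.Permutation.Propositional using (↭-sym)
open import Data.List.Relation.Binary.Permutation.Propositional.Properties using (All-resp-↭; ↭-reverse)
open import Data.List.Relation.Unary.All using (All; []; _∷_; all?)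
import Data.List.Relation.Unary.All as All
import Data.List.Relation.Unary.All.Properties as AllP
open import Data.List.Relation.Unary.All.Properties.Core using (¬Any⇒All¬)
open import Data.List.Relation.Unary.AllPairs using (AllPairs; []; _∷_)
open import Data.List.Relation.Unary.Any using (Any; here; there; any?; index)
import Data.List.Relation.Unary.Any as Any
open import Data.List.Relation.Unary.Any.Properties using (lookup-index)
open import Data.List.Relation.Unary.Unique.Propositional using (Unique)
import Data.List.Relation.Unary.Unique.Propositional.Properties as Unique
open import Data.Nat using (ℕ; zero; suc; _+_; _∸_; _≤_; _<_; _>_; _≤′_; ≤′-refl; ≤′-step; z≤n; s≤s; _<?_)
open import Data.Nat.Properties
open import Algebra.Properties.CommutativeSemigroup +-commutativeSemigroup using (x∙yz≈y∙xz)
open import Data.Product using (Σ; _×_; _,_; proj₁; proj₂)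
open import Data.Sum using (_⊎_; inj₁; inj₂; [_,_]′)
open import Data.Unit using (tt)
open import Data.Vec using (Vec; []; _∷_; _∷ʳ_; toList; sum; tabulate) renaming (initLast to initLastᵛ)
open import Data.Vec.Properties using (toList-∷ʳ)
open import Data.Vec.Relation.Binary.Pointwise.Inductive using (Pointwise; []; _∷_)
import Data.Vec.Relation.Binary.Pointwise.Inductive as PW
import Data.Vec.Relation.Unary.All as Vec
open import Data.Empty using (⊥)
open import Function using (id)
open import Level using (0ℓ)
open import Relation.Binary.Bundles using (Setoid)
open import Relation.Binary.Definitions using (Reflexive; Symmetric; Transitive)
import Relation.Binary.Reasoning.Setoid
open import Relation.Binary.PropositionalEquality using (_≡_; ≢-sym; refl; sym; trans; cong; cong₂; subst; subst₂; module ≡-Reasoning)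
open import Relation.Nullary using (¬_; Dec; yes; no; contradiction)
open import Relation.Nullary.Decidable using (map′; _×-dec_; _→-dec_)

-- Positive braid words

infixr 5 _⨾_
_⨾_ : ∀ {u v w} → u ≈ v → v ≈ w → u ≈ w
_⨾_ = ≈-trans

≈-setoid : Setoid 0ℓ 0ℓ
≈-setoid = record
  { Carrier = BWord ; _≈_ = _≈_ ; isEquivalence = record { refl = ≈-refl ; sym = ≈-sym ; trans = ≈-trans } }

module ≈-Reasoning = Relation.Binary.Reasoning.Setoid ≈-setoid

≡⇒≈ : ∀ {u v} → u ≡ v → u ≈ v
≡⇒≈ refl = ≈-refl

++-assoc-≈ : ∀ u v w → (u ++ v) ++ w ≈ u ++ (v ++ w)
++-assoc-≈ u v w = ≡⇒≈ (++-assoc u v w)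

++⁺ˡ : ∀ w {u v} → u ≈ v → w ++ u ≈ w ++ v
++⁺ˡ w ≈-refl = ≈-refl
++⁺ˡ w (≈-sym p) = ≈-sym (++⁺ˡ w p)
++⁺ˡ w (≈-trans p q) = ++⁺ˡ w p ⨾ ++⁺ˡ w q
++⁺ˡ w (≈-comm u v i j f) =
  subst₂ _≈_ (++-assoc w u (i ∷ j ∷ v)) (++-assoc w u (j ∷ i ∷ v)) (≈-comm (w ++ u) v i j f)
++⁺ˡ w (≈-braid u v i j a) =
  subst₂ _≈_ (++-assoc w u (i ∷ j ∷ i ∷ v)) (++-assoc w u (j ∷ i ∷ j ∷ v)) (≈-braid (w ++ u) v i j a)

++⁺ʳ : ∀ w {u v} → u ≈ v → u ++ w ≈ v ++ w
++⁺ʳ w ≈-refl = ≈-refl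
++⁺ʳ w (≈-sym p) = ≈-sym (++⁺ʳ w p)
++⁺ʳ w (≈-trans p q) = ++⁺ʳ w p ⨾ ++⁺ʳ w q
++⁺ʳ w (≈-comm u v i j f) =
  subst₂ _≈_ (sym (++-assoc u (i ∷ j ∷ v) w)) (sym (++-assoc u (j ∷ i ∷ v) w)) (≈-comm u (v ++ w) i j f)
++⁺ʳ w (≈-braid u v i j a) =
  subst₂ _≈_ (sym (++-assoc u (i ∷ j ∷ i ∷ v) w)) (sym (++-assoc u (j ∷ i ∷ j ∷ v) w)) (≈-braid u (v ++ w) i j a)

∷⁺ : ∀ c {u v} → u ≈ v → c ∷ u ≈ c ∷ v
∷⁺ c = ++⁺ˡ [ c ]

++⁺ : ∀ {u u′ v v′} → u ≈ u′ → v ≈ v′ → u ++ v ≈ u′ ++ v′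
++⁺ {u′ = u′} {v = v} p q = ++⁺ʳ v p ⨾ ++⁺ˡ u′ q

≈⇒length≡ : ∀ {u v} → u ≈ v → length u ≡ length v
≈⇒length≡ ≈-refl = refl
≈⇒length≡ (≈-sym p) = sym (≈⇒length≡ p)
≈⇒length≡ (≈-trans p q) = trans (≈⇒length≡ p) (≈⇒length≡ q)
≈⇒length≡ (≈-comm u v i j _) = trans (length-++ u) (sym (length-++ u))
≈⇒length≡ (≈-braid u v i j _) = trans (length-++ u) (sym (length-++ u))

module _ {P : ℕ → Set} where
  private
    All-comm-step : ∀ (u v : BWord) i j → All P (u ++ i ∷ j ∷ v) → All P (u ++ j ∷ i ∷ v)
    All-comm-step [] v i j (pi ∷ pj ∷ pv) = pj ∷ pi ∷ pv
    All-comm-step (_ ∷ u) v i j (px ∷ p) = px ∷ All-comm-step u v i j p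

    All-braid-step : ∀ (u v : BWord) i j → All P (u ++ i ∷ j ∷ i ∷ v) → All P (u ++ j ∷ i ∷ j ∷ v)
    All-braid-step [] v i j (pi ∷ pj ∷ _ ∷ pv) = pj ∷ pi ∷ pj ∷ pv
    All-braid-step (_ ∷ u) v i j (px ∷ p) = px ∷ All-braid-step u v i j p

    All-⇔-≈ : ∀ {u v} → u ≈ v → (All P u → All P v) × (All P v → All P u)
    All-⇔-≈ ≈-refl = (λ h → h) , (λ h → h)
    All-⇔-≈ (≈-sym p) = proj₂ (All-⇔-≈ p) , proj₁ (All-⇔-≈ p)
    All-⇔-≈ (≈-trans p q) =
      (λ h → proj₁ (All-⇔-≈ q) (proj₁ (All-⇔-≈ p) h)) , (λ h → proj₂ (All-⇔-≈ p) (proj₂ (All-⇔-≈ q) h))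
    All-⇔-≈ (≈-comm u v i j _) = All-comm-step u v i j , All-comm-step u v j i
    All-⇔-≈ (≈-braid u v i j _) = All-braid-step u v i j , All-braid-step u v j i

  All-resp-≈ : ∀ {u v} → u ≈ v → All P u → All P v
  All-resp-≈ p = proj₁ (All-⇔-≈ p)

Far : ℕ → ℕ → Set
Far a b = 2 + a ≤ b ⊎ 2 + b ≤ a

Adj : ℕ → ℕ → Set
Adj a b = suc a ≡ b ⊎ suc b ≡ a

Far-sym : ∀ {a b} → Far a b → Far b a
Far-sym (inj₁ p) = inj₂ p
Far-sym (inj₂ p) = inj₁ p

Adj-sym : ∀ {a b} → Adj a b → Adj b a
Adj-sym (inj₁ p) = inj₂ p
Adj-sym (inj₂ p) = inj₁ p

Far-irrefl : ∀ {a} → ¬ Far a a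
Far-irrefl (inj₁ p) = 1+n≰n (≤-trans (n≤1+n _) p)
Far-irrefl (inj₂ p) = 1+n≰n (≤-trans (n≤1+n _) p)

Adj-irrefl : ∀ {a} → ¬ Adj a a
Adj-irrefl (inj₁ ())
Adj-irrefl (inj₂ ())

Far⇒¬Adj : ∀ {a b} → Far a b → ¬ Adj a b
Far⇒¬Adj (inj₁ p) (inj₁ refl) = 1+n≰n p
Far⇒¬Adj (inj₁ p) (inj₂ refl) = 1+n≰n (≤-trans (n≤1+n _) (≤-trans (n≤1+n _) p))
Far⇒¬Adj (inj₂ p) (inj₁ refl) = 1+n≰n (≤-trans (n≤1+n _) (≤-trans (n≤1+n _) p))
Far⇒¬Adj (inj₂ p) (inj₂ refl) = 1+n≰n p

¬Adj-triangle : ∀ {a b c} → Adj a c → Adj c b → ¬ Adj a b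
¬Adj-triangle (inj₁ refl) (inj₁ refl) (inj₁ ())
¬Adj-triangle (inj₁ refl) (inj₁ refl) (inj₂ ())
¬Adj-triangle (inj₁ refl) (inj₂ refl) (inj₁ ())
¬Adj-triangle (inj₁ refl) (inj₂ refl) (inj₂ ())
¬Adj-triangle (inj₂ refl) (inj₁ refl) (inj₁ ())
¬Adj-triangle (inj₂ refl) (inj₁ refl) (inj₂ ())
¬Adj-triangle (inj₂ refl) (inj₂ refl) (inj₁ ())
¬Adj-triangle (inj₂ refl) (inj₂ refl) (inj₂ ())

data LetterRel (a b : ℕ) : Set where
  equal    : a ≡ b → LetterRel a b
  far      : Far a b → LetterRel a b
  adjacent : Adj a b → LetterRel a b

letterRel : ∀ a b → LetterRel a b
letterRel zero zero = equal refl
letterRel zero (suc zero) = adjacent (inj₁ refl)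
letterRel zero (suc (suc b)) = far (inj₁ (s≤s (s≤s z≤n)))
letterRel (suc zero) zero = adjacent (inj₂ refl)
letterRel (suc (suc a)) zero = far (inj₂ (s≤s (s≤s z≤n)))
letterRel (suc a) (suc b) with letterRel a b
... | equal e = equal (cong suc e)
... | far (inj₁ p) = far (inj₁ (s≤s p))
... | far (inj₂ p) = far (inj₂ (s≤s p))
... | adjacent (inj₁ e) = adjacent (inj₁ (cong suc e))
... | adjacent (inj₂ e) = adjacent (inj₂ (cong suc e))

-- Garside's left cancellation

-- The three ways in which a ∷ X ≈ b ∷ Y can hold (Garside).
data Reconciled (a b : ℕ) (X Y : BWord) : Set where
  same-head : a ≡ b → X ≈ Y → Reconciled a b X Y
  far-heads : Far a b → (Z : BWord) → X ≈ b ∷ Z → Y ≈ a ∷ Z → Reconciled a b X Y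
  adj-heads : Adj a b → (Z : BWord) → X ≈ b ∷ a ∷ Z → Y ≈ a ∷ b ∷ Z → Reconciled a b X Y

Reconciled-sym : ∀ {a b X Y} → Reconciled a b X Y → Reconciled b a Y X
Reconciled-sym (same-head e p) = same-head (sym e) (≈-sym p)
Reconciled-sym (far-heads f Z x y) = far-heads (Far-sym f) Z y x
Reconciled-sym (adj-heads f Z x y) = adj-heads (Adj-sym f) Z y x

Reconciled-resp : ∀ {a b X Y X′ Y′} → X ≈ X′ → Y ≈ Y′ → Reconciled a b X Y → Reconciled a b X′ Y′
Reconciled-resp p q (same-head e r) = same-head e (≈-sym p ⨾ r ⨾ q)
Reconciled-resp p q (far-heads f Z x y) = far-heads f Z (≈-sym p ⨾ x) (≈-sym q ⨾ y)
Reconciled-resp p q (adj-heads f Z x y) = adj-heads f Z (≈-sym p ⨾ x) (≈-sym q ⨾ y)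

reconciled-far : ∀ {a b X Y} → Reconciled a b X Y → Far a b → Σ BWord λ Z → X ≈ b ∷ Z × Y ≈ a ∷ Z
reconciled-far (same-head refl _) f = contradiction f Far-irrefl
reconciled-far (far-heads _ Z x y) _ = Z , x , y
reconciled-far (adj-heads a _ _ _) f = contradiction a (Far⇒¬Adj f)

reconciled-adj : ∀ {a b X Y} → Reconciled a b X Y → Adj a b → Σ BWord λ Z → X ≈ b ∷ a ∷ Z × Y ≈ a ∷ b ∷ Z
reconciled-adj (same-head refl _) a = contradiction a Adj-irrefl
reconciled-adj (far-heads f _ _ _) a = contradiction a (Far⇒¬Adj f)
reconciled-adj (adj-heads _ Z x y) _ = Z , x , y

reconciled-same : ∀ {a X Y} → Reconciled a a X Y → X ≈ Y
reconciled-same (same-head _ p) = p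
reconciled-same (far-heads f _ _ _) = contradiction f Far-irrefl
reconciled-same (adj-heads a _ _ _) = contradiction a Adj-irrefl

ReconciledBelow : ℕ → Set
ReconciledBelow N = ∀ a b X Y → length X < N → a ∷ X ≈ b ∷ Y → Reconciled a b X Y

tail-shorter : ∀ {N Z} a U → Z ≈ a ∷ U → length Z ≤ N → length U < N
tail-shorter {N} a U p h = subst (_≤ N) (≈⇒length≡ p) h

tail₂-shorter : ∀ {N Z} a c U → Z ≈ a ∷ c ∷ U → length Z ≤ N → length U < N
tail₂-shorter a c U p h = ≤-trans (n≤1+n _) (tail-shorter a (c ∷ U) p h)

-- Composing a ∷ X ≈ c ∷ Z with c ∷ Z ≈ b ∷ Y, by the relative position of the head letters a, c, b;
-- the tails are reconciled by the induction hypothesis, as they are shorter than Z.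
module Compose {N : ℕ} (ih : ReconciledBelow N) {a b c : ℕ} {X Y Z : BWord} (hZ : length Z ≤ N) where

  farFar-far : Far a c → Far c b → Far a b → ∀ {U V} → X ≈ c ∷ U → Z ≈ a ∷ U → Z ≈ b ∷ V → Y ≈ c ∷ V → Reconciled a b X Y
  farFar-far fac fcb fab {U} {V} xU zU zV yV with reconciled-far (ih a b U V (tail-shorter a U zU hZ) (≈-sym zU ⨾ zV)) fab
  ... | W , uW , vW = far-heads fab (c ∷ W) (xU ⨾ ∷⁺ c uW ⨾ ≈-comm [] W c b fcb)
                                       (yV ⨾ ∷⁺ c vW ⨾ ≈-comm [] W c a (Far-sym fac))

  farFar-adj : Far a c → Far c b → Adj a b → ∀ {U V} → X ≈ c ∷ U → Z ≈ a ∷ U → Z ≈ b ∷ V → Y ≈ c ∷ V → Reconciled a b X Y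
  farFar-adj fac fcb aab {U} {V} xU zU zV yV with reconciled-adj (ih a b U V (tail-shorter a U zU hZ) (≈-sym zU ⨾ zV)) aab
  ... | W , uW , vW = adj-heads aab (c ∷ W)
        (xU ⨾ ∷⁺ c uW ⨾ ≈-comm [] (a ∷ W) c b fcb ⨾ ≈-comm (b ∷ []) W c a (Far-sym fac))
        (yV ⨾ ∷⁺ c vW ⨾ ≈-comm [] (b ∷ W) c a (Far-sym fac) ⨾ ≈-comm (a ∷ []) W c b fcb)

  adjFar-far : Adj a c → Far c b → Far a b →
    ∀ {U V} → X ≈ c ∷ a ∷ U → Z ≈ a ∷ c ∷ U → Z ≈ b ∷ V → Y ≈ c ∷ V → Reconciled a b X Y
  adjFar-far aac fcb fab {U} {V} xU zU zV yV with reconciled-far (ih a b (c ∷ U) V (tail-shorter a (c ∷ U) zU hZ) (≈-sym zU ⨾ zV)) fab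
  ... | W , uW , vW with reconciled-far (ih c b U W (tail₂-shorter a c U zU hZ) uW) fcb
  ... | P , uP , wP = far-heads fab (c ∷ a ∷ P)
        (xU ⨾ ∷⁺ c (∷⁺ a uP) ⨾ ≈-comm (c ∷ []) P a b fab ⨾ ≈-comm [] (a ∷ P) c b fcb)
        (yV ⨾ ∷⁺ c vW ⨾ ∷⁺ c (∷⁺ a wP) ⨾ ≈-braid [] P c a (Adj-sym aac))

  adjFar-adj : Adj a c → Far c b → Adj a b →
    ∀ {U V} → X ≈ c ∷ a ∷ U → Z ≈ a ∷ c ∷ U → Z ≈ b ∷ V → Y ≈ c ∷ V → Reconciled a b X Y
  adjFar-adj aac fcb aab {U} {V} xU zU zV yV with reconciled-adj (ih a b (c ∷ U) V (tail-shorter a (c ∷ U) zU hZ) (≈-sym zU ⨾ zV)) aab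
  ... | W , uW , vW with reconciled-far (ih c b U (a ∷ W) (tail₂-shorter a c U zU hZ) uW) fcb
  ... | P , uP , wP with reconciled-adj (ih a c W P hW wP) aac
    where
    hW : length W < N
    hW = subst (_< N) (sym (suc-injective (≈⇒length≡ wP))) (tail-shorter b P uP (<⇒≤ (tail₂-shorter a c U zU hZ)))
  ... | Q , wQ , pQ = adj-heads aab (c ∷ a ∷ b ∷ Q)
        (xU ⨾ ∷⁺ c (∷⁺ a uP) ⨾ ∷⁺ c (∷⁺ a (∷⁺ b pQ))
            ⨾ ≈-braid (c ∷ []) (c ∷ Q) a b aab ⨾ ≈-comm [] (a ∷ b ∷ c ∷ Q) c b fcb
            ⨾ ≈-comm (b ∷ c ∷ a ∷ []) Q b c (Far-sym fcb) ⨾ ≈-braid (b ∷ []) (b ∷ Q) c a (Adj-sym aac))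
        (yV ⨾ ∷⁺ c vW ⨾ ∷⁺ c (∷⁺ a (∷⁺ b wQ))
            ⨾ ≈-comm (c ∷ a ∷ []) (a ∷ Q) b c (Far-sym fcb) ⨾ ≈-braid [] (b ∷ a ∷ Q) c a (Adj-sym aac)
            ⨾ ≈-braid (a ∷ c ∷ []) Q a b aab ⨾ ≈-comm (a ∷ []) (a ∷ b ∷ Q) c b fcb)

  adjAdj-far : Adj a c → Adj c b → Far a b →
    ∀ {U V} → X ≈ c ∷ a ∷ U → Z ≈ a ∷ c ∷ U → Z ≈ b ∷ c ∷ V → Y ≈ c ∷ b ∷ V → Reconciled a b X Y
  adjAdj-far aac acb fab {U} {V} xU zU zV yV
    with reconciled-far (ih a b (c ∷ U) (c ∷ V) (tail-shorter a (c ∷ U) zU hZ) (≈-sym zU ⨾ zV)) fab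
  ... | W , uW , vW
    with reconciled-adj (ih c b U W (tail₂-shorter a c U zU hZ) uW) acb
       | reconciled-adj (ih c a V W (tail₂-shorter b c V zV hZ) vW) (Adj-sym aac)
  ... | P , uP , wP | Q , vQ , wQ
    with reconciled-far (ih b a P Q (≤-trans (n≤1+n _) bP<N) (reconciled-same (ih c c (b ∷ P) (a ∷ Q) bP<N (≈-sym wP ⨾ wQ))))
                        (Far-sym fab)
    where
    bP<N : length (b ∷ P) < N
    bP<N = tail-shorter c (b ∷ P) wP (subst (_≤ N) (suc-injective (≈⇒length≡ uW)) (<⇒≤ (tail₂-shorter a c U zU hZ)))
  ... | R , pR , qR = far-heads fab (c ∷ a ∷ b ∷ c ∷ R)
        (xU ⨾ ∷⁺ c (∷⁺ a uP) ⨾ ∷⁺ c (∷⁺ a (∷⁺ b (∷⁺ c pR)))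
            ⨾ ≈-comm (c ∷ []) (c ∷ a ∷ R) a b fab ⨾ ≈-braid (c ∷ b ∷ []) R a c aac
            ⨾ ≈-braid [] (a ∷ c ∷ R) c b acb ⨾ ≈-comm (b ∷ c ∷ []) (c ∷ R) b a (Far-sym fab))
        (yV ⨾ ∷⁺ c (∷⁺ b vQ) ⨾ ∷⁺ c (∷⁺ b (∷⁺ a (∷⁺ c qR)))
            ⨾ ≈-comm (c ∷ []) (c ∷ b ∷ R) b a (Far-sym fab) ⨾ ≈-braid (c ∷ a ∷ []) R b c (Adj-sym acb)
            ⨾ ≈-braid [] (b ∷ c ∷ R) c a (Adj-sym aac))

Reconciled-trans : ∀ {N} → ReconciledBelow N → ∀ {a b c X Y Z} → length Z ≤ N →
                   Reconciled a c X Z → Reconciled c b Z Y → Reconciled a b X Y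
Reconciled-trans ih hZ (same-head refl xz) r2 = Reconciled-resp (≈-sym xz) ≈-refl r2
Reconciled-trans ih hZ (far-heads fac U xU zU) (same-head refl zy) = Reconciled-resp ≈-refl zy (far-heads fac U xU zU)
Reconciled-trans ih hZ (adj-heads aac U xU zU) (same-head refl zy) = Reconciled-resp ≈-refl zy (adj-heads aac U xU zU)
Reconciled-trans ih {a} {b} {c} hZ (far-heads fac U xU zU) (far-heads fcb V zV yV) with letterRel a b
... | equal refl = same-head refl (xU ⨾ ∷⁺ c (reconciled-same (ih a a U V (tail-shorter a U zU hZ) (≈-sym zU ⨾ zV))) ⨾ ≈-sym yV)
... | far fab = Compose.farFar-far ih hZ fac fcb fab xU zU zV yV
... | adjacent aab = Compose.farFar-adj ih hZ fac fcb aab xU zU zV yV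
Reconciled-trans ih {a} {b} {c} hZ (adj-heads aac U xU zU) (far-heads fcb V zV yV) with letterRel a b
... | equal refl = contradiction (Adj-sym aac) (Far⇒¬Adj fcb)
... | far fab = Compose.adjFar-far ih hZ aac fcb fab xU zU zV yV
... | adjacent aab = Compose.adjFar-adj ih hZ aac fcb aab xU zU zV yV
Reconciled-trans ih {a} {b} {c} hZ (far-heads fac U xU zU) (adj-heads acb V zV yV) with letterRel a b
... | equal refl = contradiction (Adj-sym acb) (Far⇒¬Adj fac)
... | far fab = Reconciled-sym (Compose.adjFar-far ih hZ (Adj-sym acb) (Far-sym fac) (Far-sym fab) yV zV zU xU)
... | adjacent aab = Reconciled-sym (Compose.adjFar-adj ih hZ (Adj-sym acb) (Far-sym fac) (Adj-sym aab) yV zV zU xU)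
Reconciled-trans ih {a} {b} {c} hZ (adj-heads aac U xU zU) (adj-heads acb V zV yV) with letterRel a b
... | equal refl = same-head refl (xU ⨾ ∷⁺ c (∷⁺ a uv) ⨾ ≈-sym yV)
  where
  cucv : c ∷ U ≈ c ∷ V
  cucv = reconciled-same (ih a a (c ∷ U) (c ∷ V) (tail-shorter a (c ∷ U) zU hZ) (≈-sym zU ⨾ zV))
  uv : U ≈ V
  uv = reconciled-same (ih c c U V (tail₂-shorter a c U zU hZ) cucv)
... | far fab = Compose.adjAdj-far ih hZ aac acb fab xU zU zV yV
... | adjacent aab = contradiction aab (¬Adj-triangle aac acb)

tails-length≡ : ∀ {u v a b X Y} → u ≈ v → u ≡ a ∷ X → v ≡ b ∷ Y → length X ≡ length Y
tails-length≡ p refl refl = suc-injective (≈⇒length≡ p)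

reconciledBelow-step : ∀ {N} → ReconciledBelow N → ∀ {u v} → u ≈ v →
                       ∀ a b X Y → u ≡ a ∷ X → v ≡ b ∷ Y → length X ≤ N → Reconciled a b X Y
reconciledBelow-step ih ≈-refl a b X Y refl refl h = same-head refl ≈-refl
reconciledBelow-step ih (≈-sym p) a b X Y e1 e2 h =
  Reconciled-sym (reconciledBelow-step ih p b a Y X e2 e1 (subst (_≤ _) (tails-length≡ (≈-sym p) e1 e2) h))
reconciledBelow-step ih (≈-trans {v = []} p q) a b X Y refl e2 h with ≈⇒length≡ p
... | ()
reconciledBelow-step {N} ih (≈-trans {v = c ∷ Z} p q) a b X Y e1 e2 h =
  Reconciled-trans ih hZ (reconciledBelow-step ih p a c X Z e1 refl h) (reconciledBelow-step ih q c b Z Y refl e2 hZ)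
  where
  hZ : length Z ≤ N
  hZ = subst (_≤ N) (tails-length≡ p e1 refl) h
reconciledBelow-step ih (≈-comm [] v i j c) a b X Y refl refl h = far-heads c v ≈-refl ≈-refl
reconciledBelow-step ih (≈-comm (x ∷ u) v i j c) a b X Y refl refl h = same-head refl (≈-comm u v i j c)
reconciledBelow-step ih (≈-braid [] v i j c) a b X Y refl refl h = adj-heads c v ≈-refl ≈-refl
reconciledBelow-step ih (≈-braid (x ∷ u) v i j c) a b X Y refl refl h = same-head refl (≈-braid u v i j c)

reconciledBelow : ∀ N → ReconciledBelow N
reconciledBelow zero a b X Y () p
reconciledBelow (suc N) a b X Y (s≤s h) p = reconciledBelow-step (reconciledBelow N) p a b X Y refl refl h

reconcile : ∀ {a b X Y} → a ∷ X ≈ b ∷ Y → Reconciled a b X Y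
reconcile {a} {b} {X} {Y} p = reconciledBelow (suc (length X)) a b X Y ≤-refl p

∷-cancel : ∀ {a X Y} → a ∷ X ≈ a ∷ Y → X ≈ Y
∷-cancel p = reconciled-same (reconcile p)

++-cancelˡ : ∀ w {X Y} → w ++ X ≈ w ++ Y → X ≈ Y
++-cancelˡ [] p = p
++-cancelˡ (a ∷ w) p = ++-cancelˡ w (∷-cancel p)

-- Least common right multiples

record RightLcm (u v : BWord) : Set where
  field
    u⁺     : BWord
    v⁺     : BWord
    common : u ++ u⁺ ≈ v ++ v⁺
    least  : ∀ x y → u ++ x ≈ v ++ y → Σ BWord λ z → x ≈ u⁺ ++ z × y ≈ v⁺ ++ z
open RightLcm

RightLcm-sym : ∀ {u v} → RightLcm u v → RightLcm v u
RightLcm-sym L = record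
  { u⁺ = v⁺ L ; v⁺ = u⁺ L ; common = ≈-sym (common L)
  ; least = λ x y p → let z , y≈ , x≈ = least L y x (≈-sym p) in z , x≈ , y≈ }

RightLcm-++ˡ : ∀ {u₁ u₂ v} (L₁ : RightLcm u₁ v) → RightLcm u₂ (u⁺ L₁) → RightLcm (u₁ ++ u₂) v
RightLcm-++ˡ {u₁} {u₂} {v} L₁ L₂ = record
  { u⁺ = u⁺ L₂ ; v⁺ = v⁺ L₁ ++ v⁺ L₂
  ; common = ++-assoc-≈ u₁ u₂ (u⁺ L₂) ⨾ ++⁺ˡ u₁ (common L₂) ⨾ ≈-sym (++-assoc-≈ u₁ (u⁺ L₁) (v⁺ L₂))
             ⨾ ++⁺ʳ (v⁺ L₂) (common L₁) ⨾ ++-assoc-≈ v (v⁺ L₁) (v⁺ L₂)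
  ; least = least₁₂ }
  where
  least₁₂ : ∀ x y → (u₁ ++ u₂) ++ x ≈ v ++ y → Σ BWord λ z → x ≈ u⁺ L₂ ++ z × y ≈ (v⁺ L₁ ++ v⁺ L₂) ++ z
  least₁₂ x y p with least L₁ (u₂ ++ x) y (≈-sym (++-assoc-≈ u₁ u₂ x) ⨾ p)
  ... | z , u₂x≈ , y≈ with least L₂ x z u₂x≈
  ... | t , x≈ , z≈ = t , x≈ , (y≈ ⨾ ++⁺ˡ (v⁺ L₁) z≈ ⨾ ≈-sym (++-assoc-≈ (v⁺ L₁) (v⁺ L₂) t))

RightLcm-++ʳ : ∀ {u v₁ v₂} (L₁ : RightLcm u v₁) → RightLcm v₂ (v⁺ L₁) → RightLcm u (v₁ ++ v₂)
RightLcm-++ʳ L₁ L₂ = RightLcm-sym (RightLcm-++ˡ (RightLcm-sym L₁) L₂)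

letterLcm : ∀ a b → RightLcm [ a ] [ b ]
letterLcm a b with letterRel a b
... | equal refl = record
  { u⁺ = [] ; v⁺ = [] ; common = ≈-refl ; least = λ x y p → y , reconciled-same (reconcile p) , ≈-refl }
... | far f = record
  { u⁺ = [ b ] ; v⁺ = [ a ] ; common = ≈-comm [] [] a b f ; least = λ x y p → reconciled-far (reconcile p) f }
... | adjacent f = record
  { u⁺ = b ∷ a ∷ [] ; v⁺ = a ∷ b ∷ [] ; common = ≈-braid [] [] a b f ; least = λ x y p → reconciled-adj (reconcile p) f }

-- lcm(a u, b v) is built from lcm(a, b), an lcm of v with the complement of b, and an lcm of u with
-- the complement of a in lcm(a, b v); both recursive calls come with a common multiple one letter shorter.
rightLcmBelow : ∀ N u v x y → length (u ++ x) ≤ N → u ++ x ≈ v ++ y → RightLcm u v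
rightLcmBelow N [] v x y _ _ = record
  { u⁺ = v ; v⁺ = [] ; common = ≡⇒≈ (sym (++-identityʳ v)) ; least = λ x y p → y , p , ≈-refl }
rightLcmBelow N (a ∷ u) [] x y _ _ = record
  { u⁺ = [] ; v⁺ = a ∷ u ; common = ≡⇒≈ (++-identityʳ (a ∷ u)) ; least = λ x y p → x , ≈-refl , ≈-sym p }
rightLcmBelow (suc N) (a ∷ u) (b ∷ v) x y (s≤s h) p = RightLcm-++ˡ {[ a ]} Lₐ (rightLcmBelow N u (u⁺ Lₐ) x z₂ h ux≈)
  where
  Lab = letterLcm a b
  z₁ = proj₁ (least Lab (u ++ x) (v ++ y) p)
  vy≈ : v ++ y ≈ v⁺ Lab ++ z₁
  vy≈ = proj₂ (proj₂ (least Lab (u ++ x) (v ++ y) p))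
  Lₐ : RightLcm [ a ] (b ∷ v)
  Lₐ = RightLcm-++ʳ {v₁ = [ b ]} Lab
         (rightLcmBelow N v (v⁺ Lab) y z₁ (subst (_≤ N) (suc-injective (≈⇒length≡ p)) h) vy≈)
  z₂ = proj₁ (least Lₐ (u ++ x) y p)
  ux≈ : u ++ x ≈ u⁺ Lₐ ++ z₂
  ux≈ = proj₁ (proj₂ (least Lₐ (u ++ x) y p))

rightLcm : ∀ {u v x y} → u ++ x ≈ v ++ y → RightLcm u v
rightLcm {u} {v} {x} {y} = rightLcmBelow (length (u ++ x)) u v x y ≤-refl

-- Divisibility

-- Divisibility among all positive words; LDiv additionally bounds the letters of the cofactor.
infix 4 _≼_
_≼_ : BWord → BWord → Set
u ≼ v = Σ BWord λ z → v ≈ u ++ z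

infix 4 _≼ʳ_
_≼ʳ_ : BWord → BWord → Set
u ≼ʳ v = Σ BWord λ z → v ≈ z ++ u

≼-trans : ∀ {u v w} → u ≼ v → v ≼ w → u ≼ w
≼-trans {u} (a , v≈) (b , w≈) = a ++ b , (w≈ ⨾ ++⁺ʳ b v≈ ⨾ ++-assoc-≈ u a b)

≼-respˡ : ∀ {u u′ v} → u ≈ u′ → u ≼ v → u′ ≼ v
≼-respˡ u≈ (z , v≈) = z , (v≈ ⨾ ++⁺ʳ z u≈)

¬[]≈∷ : ∀ {k q} → ¬ ([] ≈ k ∷ q)
¬[]≈∷ p with ≈⇒length≡ p
... | ()

letter≼?Below : ∀ N k u → length u ≤ N → Dec ([ k ] ≼ u)
letter≼?Below N k [] _ = no λ (_ , p) → ¬[]≈∷ p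
letter≼?Below (suc N) k (i ∷ u) (s≤s h) with letterRel i k
... | equal refl = yes (u , ≈-refl)
... | far f with letter≼?Below N k u h
...   | yes (q , p) = yes (i ∷ q , ∷⁺ i p ⨾ ≈-comm [] q i k f)
...   | no ¬k≼u = no λ (_ , p) → let Z , u≈ , _ = reconciled-far (reconcile p) f in ¬k≼u (Z , u≈)
letter≼?Below (suc N) k (i ∷ u) (s≤s h) | adjacent a with letter≼?Below N k u h
...   | no ¬k≼u = no λ (_ , p) → let Z , u≈ , _ = reconciled-adj (reconcile p) a in ¬k≼u (i ∷ Z , u≈)
...   | yes (q , p) with letter≼?Below N i q (≤-trans (n≤1+n _) (subst (_≤ N) (≈⇒length≡ p) h))
...     | yes (q′ , p′) = yes (i ∷ k ∷ q′ , ∷⁺ i (p ⨾ ∷⁺ k p′) ⨾ ≈-braid [] q′ i k a)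
...     | no ¬i≼q = no λ (_ , p″) → let Z , u≈ , _ = reconciled-adj (reconcile p″) a in ¬i≼q (Z , ∷-cancel (≈-sym p ⨾ u≈))

letter≼? : ∀ k u → Dec ([ k ] ≼ u)
letter≼? k u = letter≼?Below (length u) k u ≤-refl

_≈?_ : ∀ u v → Dec (u ≈ v)
[] ≈? [] = yes ≈-refl
[] ≈? (_ ∷ _) = no ¬[]≈∷
(k ∷ u) ≈? v with letter≼? k v
... | no ¬k≼v = no λ p → ¬k≼v (u , ≈-sym p)
... | yes (q , p) with u ≈? q
...   | yes u≈q = yes (∷⁺ k u≈q ⨾ ≈-sym p)
...   | no ¬u≈q = no λ p′ → ¬u≈q (∷-cancel (p′ ⨾ p))

_≼?_ : ∀ u v → Dec (u ≼ v)
[] ≼? v = yes (v , ≈-refl)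
(k ∷ u) ≼? v with letter≼? k v
... | no ¬k≼v = no λ (z , p) → ¬k≼v (u ++ z , p)
... | yes (q , p) with u ≼? q
...   | yes (z , q≈) = yes (z , p ⨾ ∷⁺ k q≈)
...   | no ¬u≼q = no λ (z , p′) → ¬u≼q (z , ∷-cancel (≈-sym p ⨾ p′))

IsWord? : ∀ n w → Dec (IsWord n w)
IsWord? n = all? (λ i → suc i <? n)

LDiv? : ∀ n x y → Dec (LDiv n x y)
LDiv? n x y with x ≼? y
... | no ¬x≼y = no λ (z , _ , p) → ¬x≼y (z , ≈-sym p)
... | yes (z , p) with IsWord? n z
...   | yes z-word = yes (z , z-word , ≈-sym p)
...   | no ¬z-word = no λ (z′ , z′-word , p′) → ¬z-word (All-resp-≈ (++-cancelˡ x (p′ ⨾ p)) z′-word)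

reverse-infix : ∀ (u m v : BWord) → reverse (u ++ m ++ v) ≡ reverse v ++ reverse m ++ reverse u
reverse-infix u m v =
  trans (reverse-++ u (m ++ v)) (trans (cong (_++ reverse u) (reverse-++ m v)) (++-assoc (reverse v) (reverse m) (reverse u)))

reverse-≈ : ∀ {u v} → u ≈ v → reverse u ≈ reverse v
reverse-≈ ≈-refl = ≈-refl
reverse-≈ (≈-sym p) = ≈-sym (reverse-≈ p)
reverse-≈ (≈-trans p q) = reverse-≈ p ⨾ reverse-≈ q
reverse-≈ (≈-comm u v i j f) =
  subst₂ _≈_ (sym (reverse-infix u (i ∷ j ∷ []) v)) (sym (reverse-infix u (j ∷ i ∷ []) v))
    (≈-comm (reverse v) (reverse u) j i (Far-sym f))
reverse-≈ (≈-braid u v i j a) =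
  subst₂ _≈_ (sym (reverse-infix u (i ∷ j ∷ i ∷ []) v)) (sym (reverse-infix u (j ∷ i ∷ j ∷ []) v))
    (≈-braid (reverse v) (reverse u) i j a)

reverse-≈⁻ : ∀ {u v} → reverse u ≈ reverse v → u ≈ v
reverse-≈⁻ {u} {v} p = subst₂ _≈_ (reverse-involutive u) (reverse-involutive v) (reverse-≈ p)

All-reverse : ∀ {P : ℕ → Set} {w} → All P w → All P (reverse w)
All-reverse {w = w} = All-resp-↭ (↭-sym (↭-reverse w))

≼ʳ⇒reverse≼ : ∀ {u v} → u ≼ʳ v → reverse u ≼ reverse v
≼ʳ⇒reverse≼ {u} (z , p) = reverse z , (reverse-≈ p ⨾ ≡⇒≈ (reverse-++ z u))

reverse≼⇒≼ʳ : ∀ {u v} → reverse u ≼ reverse v → u ≼ʳ v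
reverse≼⇒≼ʳ {u} (z , p) =
  reverse z , reverse-≈⁻ (p ⨾ ≡⇒≈ (sym (trans (reverse-++ (reverse z) u) (cong (reverse u ++_) (reverse-involutive z)))))

RDiv? : ∀ n x y → Dec (RDiv n x y)
RDiv? n x y = map′ from-reverse to-reverse (LDiv? n (reverse x) (reverse y))
  where
  to-reverse : RDiv n x y → LDiv n (reverse x) (reverse y)
  to-reverse (z , z-word , p) = reverse z , All-reverse z-word , ≈-sym (proj₂ (≼ʳ⇒reverse≼ (z , ≈-sym p)))
  from-reverse : LDiv n (reverse x) (reverse y) → RDiv n x y
  from-reverse (z , z-word , p) = reverse z , All-reverse z-word , ≈-sym (proj₂ (reverse≼⇒≼ʳ {x} {y} (z , ≈-sym p)))

-- The Garside element Δ

commute-past : ∀ k (w r : BWord) → All (Far k) w → k ∷ (w ++ r) ≈ w ++ k ∷ r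
commute-past k [] r [] = ≈-refl
commute-past k (i ∷ w) r (f ∷ fs) = ≈-comm [] (w ++ r) k i f ⨾ ∷⁺ i (commute-past k w r fs)

upTo-< : ∀ m → All (_< m) (upTo m)
upTo-< m = AllP.applyUpTo⁺₁ id m id

downFrom-< : ∀ m → All (_< m) (downFrom m)
downFrom-< m = AllP.applyDownFrom⁺₁ id m id

upTo-suc-++ : ∀ m (r : BWord) → upTo (suc m) ++ r ≡ upTo m ++ m ∷ r
upTo-suc-++ m r = trans (cong (_++ r) (sym (upTo-∷ʳ m))) (++-assoc (upTo m) [ m ] r)

IsWord-mono : ∀ {m n w} → m ≤ n → IsWord m w → IsWord n w
IsWord-mono m≤n = All.map (λ p → ≤-trans p m≤n)

IsWord⇒Far : ∀ {m w} → IsWord m w → All (Far m) w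
IsWord⇒Far = All.map inj₂

Far-suc : ∀ {k w} → All (_< k) w → All (Far (suc k)) w
Far-suc = All.map (λ p → inj₂ (s≤s p))

Δ-isWord : ∀ m → IsWord m (Δ m)
Δ-isWord zero = []
Δ-isWord (suc m) = AllP.++⁺ (All.map s≤s (upTo-< m)) (IsWord-mono (n≤1+n m) (Δ-isWord m))

Δ-suc≈ : ∀ m → Δ (suc m) ≈ Δ m ++ downFrom m
Δ-suc≈ zero = ≈-refl
Δ-suc≈ (suc k) = begin
  upTo (suc k) ++ Δ (suc k)            ≈⟨ ++⁺ˡ (upTo (suc k)) (Δ-suc≈ k) ⟩
  upTo (suc k) ++ Δ k ++ downFrom k    ≡⟨ upTo-suc-++ k (Δ k ++ downFrom k) ⟩
  upTo k ++ k ∷ (Δ k ++ downFrom k)    ≈⟨ ++⁺ˡ (upTo k) (commute-past k (Δ k) (downFrom k) (IsWord⇒Far (Δ-isWord k))) ⟩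
  upTo k ++ Δ k ++ k ∷ downFrom k      ≈⟨ ++-assoc-≈ (upTo k) (Δ k) (k ∷ downFrom k) ⟨
  Δ (suc k) ++ downFrom (suc k)        ∎
  where open ≈-Reasoning

∷-upTo≈ : ∀ m j (r : BWord) → suc j < m → suc j ∷ (upTo m ++ r) ≈ upTo m ++ j ∷ r
∷-upTo≈ (suc m) j r (s≤s j+2≤m) with m≤n⇒m<n∨m≡n j+2≤m
... | inj₁ j+2<m = begin
  suc j ∷ (upTo (suc m) ++ r)     ≡⟨ cong (suc j ∷_) (upTo-suc-++ m r) ⟩
  suc j ∷ (upTo m ++ m ∷ r)       ≈⟨ ∷-upTo≈ m j (m ∷ r) j+2<m ⟩
  upTo m ++ j ∷ m ∷ r             ≈⟨ ++⁺ˡ (upTo m) (≈-comm [] r j m (inj₁ j+2<m)) ⟩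
  upTo m ++ m ∷ j ∷ r             ≡⟨ upTo-suc-++ m (j ∷ r) ⟨
  upTo (suc m) ++ j ∷ r           ∎
  where open ≈-Reasoning
... | inj₂ refl = begin
  suc j ∷ (upTo (suc (suc j)) ++ r)      ≡⟨ cong (suc j ∷_) (upTo-suc₂-++ r) ⟩
  suc j ∷ (upTo j ++ j ∷ suc j ∷ r)      ≈⟨ commute-past (suc j) (upTo j) (j ∷ suc j ∷ r) (Far-suc (upTo-< j)) ⟩
  upTo j ++ suc j ∷ j ∷ suc j ∷ r        ≈⟨ ++⁺ˡ (upTo j) (≈-braid [] r (suc j) j (inj₂ refl)) ⟩
  upTo j ++ j ∷ suc j ∷ j ∷ r            ≡⟨ upTo-suc₂-++ (j ∷ r) ⟨
  upTo (suc (suc j)) ++ j ∷ r            ∎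
  where
  open ≈-Reasoning
  upTo-suc₂-++ : ∀ (r : BWord) → upTo (suc (suc j)) ++ r ≡ upTo j ++ j ∷ suc j ∷ r
  upTo-suc₂-++ r = trans (upTo-suc-++ (suc j) r) (upTo-suc-++ j (suc j ∷ r))

Δ-conj : ∀ j k → j ∷ Δ (2 + j + k) ≈ Δ (2 + j + k) ++ [ k ]
Δ-conj (suc j) k = begin
  suc j ∷ (upTo (2 + j + k) ++ Δ (2 + j + k))   ≈⟨ ∷-upTo≈ (2 + j + k) j (Δ (2 + j + k)) (s≤s (s≤s (m≤m+n j k))) ⟩
  upTo (2 + j + k) ++ j ∷ Δ (2 + j + k)         ≈⟨ ++⁺ˡ (upTo (2 + j + k)) (Δ-conj j k) ⟩
  upTo (2 + j + k) ++ Δ (2 + j + k) ++ [ k ]    ≈⟨ ++-assoc-≈ (upTo (2 + j + k)) (Δ (2 + j + k)) [ k ] ⟨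
  Δ (3 + j + k) ++ [ k ]                        ∎
  where open ≈-Reasoning
Δ-conj zero zero = ≈-refl
Δ-conj zero (suc k) = begin
  0 ∷ Δ (3 + k)                                   ≈⟨ ∷⁺ 0 (Δ-suc≈ (2 + k)) ⟩
  0 ∷ Δ (2 + k) ++ downFrom (2 + k)               ≈⟨ ++⁺ʳ (downFrom (2 + k)) (Δ-conj zero k) ⟩
  (Δ (2 + k) ++ [ k ]) ++ downFrom (2 + k)        ≈⟨ ++-assoc-≈ (Δ (2 + k)) [ k ] (downFrom (2 + k)) ⟩
  Δ (2 + k) ++ k ∷ suc k ∷ k ∷ downFrom k         ≈⟨ ++⁺ˡ (Δ (2 + k)) (≈-braid [] (downFrom k) k (suc k) (inj₁ refl)) ⟩
  Δ (2 + k) ++ suc k ∷ k ∷ suc k ∷ downFrom k     ≡⟨ cong (λ t → Δ (2 + k) ++ suc k ∷ k ∷ suc k ∷ t) (sym (++-identityʳ (downFrom k))) ⟩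
  Δ (2 + k) ++ suc k ∷ k ∷ suc k ∷ (downFrom k ++ [])
    ≈⟨ ++⁺ˡ (Δ (2 + k)) (∷⁺ (suc k) (∷⁺ k (commute-past (suc k) (downFrom k) [] (Far-suc (downFrom-< k))))) ⟩
  Δ (2 + k) ++ downFrom (2 + k) ++ [ suc k ]      ≈⟨ ++-assoc-≈ (Δ (2 + k)) (downFrom (2 + k)) [ suc k ] ⟨
  (Δ (2 + k) ++ downFrom (2 + k)) ++ [ suc k ]    ≈⟨ ++⁺ʳ [ suc k ] (Δ-suc≈ (2 + k)) ⟨
  Δ (3 + k) ++ [ suc k ]                          ∎
  where open ≈-Reasoning

letter≼Δ : ∀ {m j} → suc j < m → [ j ] ≼ Δ m
letter≼Δ {suc (suc m)} {zero} _ = applyUpTo suc m ++ Δ (suc m) , ≈-refl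
letter≼Δ {suc m} {suc j} (s≤s j+2<m) =
  let e , Δ≈ = letter≼Δ j+2<m in upTo m ++ e , (++⁺ˡ (upTo m) Δ≈ ⨾ ≈-sym (∷-upTo≈ m j e j+2<m))

Δ-≼′ : ∀ {m n} → m ≤′ n → Δ m ≼ Δ n
Δ-≼′ ≤′-refl = [] , ≡⇒≈ (sym (++-identityʳ _))
Δ-≼′ (≤′-step {n} m≤′n) = ≼-trans (Δ-≼′ m≤′n) (downFrom n , Δ-suc≈ n)

Δ-≼ : ∀ {m n} → m ≤ n → Δ m ≼ Δ n
Δ-≼ m≤n = Δ-≼′ (≤⇒≤′ m≤n)

reverse-Δ : ∀ m → reverse (Δ m) ≈ Δ m
reverse-Δ zero = ≈-refl
reverse-Δ (suc m) =
  ≡⇒≈ (reverse-++ (upTo m) (Δ m)) ⨾ ++⁺ (reverse-Δ m) (≡⇒≈ (reverse-upTo m)) ⨾ ≈-sym (Δ-suc≈ m)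

Δ-conj-letter : ∀ {n j} → suc j < n → Σ ℕ λ k → suc k < n × j ∷ Δ n ≈ Δ n ++ [ k ]
Δ-conj-letter {suc (suc n)} {j} (s≤s (s≤s j≤n)) =
  n ∸ j , s≤s (s≤s (m∸n≤m n j)) ,
  subst (λ t → j ∷ Δ (2 + t) ≈ Δ (2 + t) ++ [ n ∸ j ]) (m+[n∸m]≡n j≤n) (Δ-conj j (n ∸ j))

Δ-conj-letterʳ : ∀ {n k} → suc k < n → Σ ℕ λ j → suc j < n × j ∷ Δ n ≈ Δ n ++ [ k ]
Δ-conj-letterʳ {suc (suc n)} {k} (s≤s (s≤s k≤n)) =
  n ∸ k , s≤s (s≤s (m∸n≤m n k)) ,
  subst (λ t → (n ∸ k) ∷ Δ (2 + t) ≈ Δ (2 + t) ++ [ k ]) (m∸n+n≡m k≤n) (Δ-conj (n ∸ k) k)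

Δ-quasiCentral : ∀ {n a} → IsWord n a → Σ BWord λ b → a ++ Δ n ≈ Δ n ++ b
Δ-quasiCentral {n} [] = [] , ≡⇒≈ (sym (++-identityʳ (Δ n)))
Δ-quasiCentral {n} {j ∷ a} (j<n ∷ a-word) =
  let b , a≈ = Δ-quasiCentral a-word ; k , _ , j≈ = Δ-conj-letter j<n
  in k ∷ b , (∷⁺ j a≈ ⨾ ++⁺ʳ b j≈ ⨾ ++-assoc-≈ (Δ n) [ k ] b)

letter≼-past-far : ∀ {k p q} → All (Far k) p → [ k ] ≼ p ++ q → [ k ] ≼ q
letter≼-past-far [] k≼ = k≼
letter≼-past-far (f ∷ fs) (_ , e) = let Z , e₁ , _ = reconciled-far (reconcile e) (Far-sym f) in letter≼-past-far fs (Z , e₁)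

downFrom-lcm : ∀ k {w} → [ k ] ≼ downFrom k ++ w → downFrom (suc k) ≼ w
downFrom-lcm zero k≼ = k≼
downFrom-lcm (suc k) {w} (_ , e) with reconciled-adj (reconcile e) (inj₁ refl)
... | Z , e₁ , _ with letter≼-past-far (Far-suc (downFrom-< k)) (k ∷ Z , e₁)
... | w₂ , w≈ with downFrom-lcm k {w₂} (Z , ∷-cancel (commute-past (suc k) (downFrom k) w₂ (Far-suc (downFrom-< k))
                                                     ⨾ ≈-sym (++⁺ˡ (downFrom k) w≈) ⨾ e₁))
... | z , w₂≈ = z , (w≈ ⨾ ∷⁺ (suc k) w₂≈)

Δ-lcm : ∀ m {w} → (∀ {j} → suc j < m → [ j ] ≼ w) → Δ m ≼ w
Δ-lcm zero {w} _ = w , ≈-refl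
Δ-lcm (suc zero) {w} _ = w , ≈-refl
Δ-lcm (suc (suc m)) {w} letters≼ with Δ-lcm (suc m) (λ p → letters≼ (≤-trans p (n≤1+n _))) | letters≼ ≤-refl
... | w₁ , w≈ | z , w≈′ with letter≼-past-far {q = downFrom m ++ w₁} (IsWord⇒Far (Δ-isWord m)) (z , Δw₁≈)
  where
  Δw₁≈ : Δ m ++ downFrom m ++ w₁ ≈ m ∷ z
  Δw₁≈ = ≈-sym (++-assoc-≈ (Δ m) (downFrom m) w₁) ⨾ ++⁺ʳ w₁ (≈-sym (Δ-suc≈ m)) ⨾ ≈-sym w≈ ⨾ w≈′
... | q , q≈ with downFrom-lcm m (q , q≈)
... | z′ , w₁≈ = z′ , (w≈ ⨾ ++⁺ˡ (Δ (suc m)) w₁≈ ⨾ ≈-sym (++-assoc-≈ (Δ (suc m)) (downFrom (suc m)) z′)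
                      ⨾ ++⁺ʳ z′ (≈-sym (Δ-suc≈ (suc m))))

Δ-lcmʳ : ∀ m {y} → (∀ {j} → suc j < m → [ j ] ≼ʳ y) → Δ m ≼ʳ y
Δ-lcmʳ m {y} letters≼ʳ =
  reverse≼⇒≼ʳ {Δ m} {y} (≼-respˡ (≈-sym (reverse-Δ m)) (Δ-lcm m (λ p → ≼ʳ⇒reverse≼ (letters≼ʳ p))))

-- Permutation braids

-- swap p exchanges the entries at positions p and p + 1, and is the identity when p + 1 is out of range.
swap : ℕ → List ℕ → List ℕ
swap zero [] = []
swap zero (x ∷ []) = x ∷ []
swap zero (x ∷ y ∷ l) = y ∷ x ∷ l
swap (suc p) [] = []
swap (suc p) (x ∷ l) = x ∷ swap p l

act : BWord → List ℕ → List ℕ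
act [] l = l
act (i ∷ w) l = act w (swap i l)

act-++ : ∀ u v l → act (u ++ v) l ≡ act v (act u l)
act-++ [] v l = refl
act-++ (i ∷ u) v l = act-++ u v (swap i l)

length-swap : ∀ p l → length (swap p l) ≡ length l
length-swap zero [] = refl
length-swap zero (x ∷ []) = refl
length-swap zero (x ∷ y ∷ l) = refl
length-swap (suc p) [] = refl
length-swap (suc p) (x ∷ l) = cong suc (length-swap p l)

length-act : ∀ w l → length (act w l) ≡ length l
length-act [] l = refl
length-act (i ∷ w) l = trans (length-act w (swap i l)) (length-swap i l)

swap-involutive : ∀ p l → swap p (swap p l) ≡ l
swap-involutive zero [] = refl
swap-involutive zero (x ∷ []) = refl
swap-involutive zero (x ∷ y ∷ l) = refl
swap-involutive (suc p) [] = refl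
swap-involutive (suc p) (x ∷ l) = cong (x ∷_) (swap-involutive p l)

swap-comm : ∀ i j l → 2 + i ≤ j → swap i (swap j l) ≡ swap j (swap i l)
swap-comm zero (suc (suc j)) [] _ = refl
swap-comm zero (suc (suc j)) (x ∷ []) _ = refl
swap-comm zero (suc (suc j)) (x ∷ y ∷ l) _ = refl
swap-comm zero (suc zero) _ (s≤s ())
swap-comm (suc i) (suc j) [] _ = refl
swap-comm (suc i) (suc j) (x ∷ l) (s≤s i+2≤j) = cong (x ∷_) (swap-comm i j l i+2≤j)

swap-comm-far : ∀ i j l → Far i j → swap j (swap i l) ≡ swap i (swap j l)
swap-comm-far i j l (inj₁ i+2≤j) = sym (swap-comm i j l i+2≤j)
swap-comm-far i j l (inj₂ j+2≤i) = swap-comm j i l j+2≤i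

swap-braid : ∀ i l → 2 + i < length l → swap i (swap (suc i) (swap i l)) ≡ swap (suc i) (swap i (swap (suc i) l))
swap-braid zero (x ∷ y ∷ z ∷ l) _ = refl
swap-braid zero (x ∷ []) (s≤s ())
swap-braid zero (x ∷ y ∷ []) (s≤s (s≤s ()))
swap-braid (suc i) (x ∷ l) (s≤s i+3<l) = cong (x ∷_) (swap-braid i l i+3<l)

act-≈ : ∀ {u v} → u ≈ v → ∀ l → IsWord (length l) u → act u l ≡ act v l
act-≈ ≈-refl l _ = refl
act-≈ (≈-sym p) l u-word = sym (act-≈ p l (All-resp-≈ (≈-sym p) u-word))
act-≈ (≈-trans p q) l u-word = trans (act-≈ p l u-word) (act-≈ q l (All-resp-≈ p u-word))
act-≈ (≈-comm u v i j f) l _ = begin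
  act (u ++ i ∷ j ∷ v) l        ≡⟨ act-++ u (i ∷ j ∷ v) l ⟩
  act v (swap j (swap i l′))    ≡⟨ cong (act v) (swap-comm-far i j l′ f) ⟩
  act v (swap i (swap j l′))    ≡⟨ act-++ u (j ∷ i ∷ v) l ⟨
  act (u ++ j ∷ i ∷ v) l        ∎
  where
  open ≡-Reasoning
  l′ = act u l
act-≈ (≈-braid u v i j a) l u-word with AllP.++⁻ʳ u u-word | a
... | _ ∷ j+1<l ∷ _ | inj₁ refl = begin
  act (u ++ i ∷ j ∷ i ∷ v) l                    ≡⟨ act-++ u (i ∷ j ∷ i ∷ v) l ⟩
  act v (swap i (swap j (swap i (act u l))))    ≡⟨ cong (act v) (swap-braid i (act u l) (subst (suc j <_) (sym (length-act u l)) j+1<l)) ⟩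
  act v (swap j (swap i (swap j (act u l))))    ≡⟨ act-++ u (j ∷ i ∷ j ∷ v) l ⟨
  act (u ++ j ∷ i ∷ j ∷ v) l                    ∎
  where open ≡-Reasoning
... | i+1<l ∷ _ | inj₂ refl = begin
  act (u ++ i ∷ j ∷ i ∷ v) l                    ≡⟨ act-++ u (i ∷ j ∷ i ∷ v) l ⟩
  act v (swap i (swap j (swap i (act u l))))    ≡⟨ cong (act v) (swap-braid j (act u l) (subst (suc i <_) (sym (length-act u l)) i+1<l)) ⟨
  act v (swap j (swap i (swap j (act u l))))    ≡⟨ act-++ u (j ∷ i ∷ j ∷ v) l ⟨
  act (u ++ j ∷ i ∷ j ∷ v) l                    ∎
  where open ≡-Reasoning

less : ℕ → ℕ → ℕ
less zero zero = 0
less zero (suc x) = 1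
less (suc y) zero = 0
less (suc y) (suc x) = less y x

smaller : ℕ → List ℕ → ℕ
smaller x [] = 0
smaller x (y ∷ l) = less y x + smaller x l

inversions : List ℕ → ℕ
inversions [] = 0
inversions (x ∷ l) = smaller x l + inversions l

less-< : ∀ {y x} → y < x → less y x ≡ 1
less-< {zero} {suc x} _ = refl
less-< {suc y} {suc x} (s≤s y<x) = less-< y<x

less-≥ : ∀ {y x} → x ≤ y → less y x ≡ 0
less-≥ {zero} {zero} _ = refl
less-≥ {suc y} {zero} _ = refl
less-≥ {suc y} {suc x} (s≤s x≤y) = less-≥ x≤y

less≤1 : ∀ y x → less y x ≤ 1
less≤1 zero zero = z≤n
less≤1 zero (suc x) = ≤-refl
less≤1 (suc y) zero = z≤n
less≤1 (suc y) (suc x) = less≤1 y x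

smaller-swap : ∀ x p l → smaller x (swap p l) ≡ smaller x l
smaller-swap x zero [] = refl
smaller-swap x zero (y ∷ []) = refl
smaller-swap x zero (y ∷ z ∷ l) = x∙yz≈y∙xz (less z x) (less y x) (smaller x l)
smaller-swap x (suc p) [] = refl
smaller-swap x (suc p) (y ∷ l) = cong (less y x +_) (smaller-swap x p l)

inversions-∷∷ : ∀ x y l → inversions (x ∷ y ∷ l) ≡ less y x + (smaller x l + (smaller y l + inversions l))
inversions-∷∷ x y l = +-assoc (less y x) (smaller x l) (smaller y l + inversions l)

inversions-∷∷-swap : ∀ x y l → inversions (y ∷ x ∷ l) ≡ less x y + (smaller x l + (smaller y l + inversions l))
inversions-∷∷-swap x y l = trans (inversions-∷∷ y x l) (cong (less x y +_) (x∙yz≈y∙xz (smaller y l) (smaller x l) (inversions l)))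

Ascent : ℕ → List ℕ → Set
Ascent zero (x ∷ y ∷ l) = x < y
Ascent zero _ = ⊥
Ascent (suc p) [] = ⊥
Ascent (suc p) (x ∷ l) = Ascent p l

Descent : ℕ → List ℕ → Set
Descent zero (x ∷ y ∷ l) = y < x
Descent zero _ = ⊥
Descent (suc p) [] = ⊥
Descent (suc p) (x ∷ l) = Descent p l

ascent? : ∀ p l → Dec (Ascent p l)
ascent? zero [] = no λ ()
ascent? zero (x ∷ []) = no λ ()
ascent? zero (x ∷ y ∷ l) = x <? y
ascent? (suc p) [] = no λ ()
ascent? (suc p) (x ∷ l) = ascent? p l

descent? : ∀ p l → Dec (Descent p l)
descent? zero [] = no λ ()
descent? zero (x ∷ []) = no λ ()
descent? zero (x ∷ y ∷ l) = y <? x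
descent? (suc p) [] = no λ ()
descent? (suc p) (x ∷ l) = descent? p l

Ascent⇒Descent-swap : ∀ p l → Ascent p l → Descent p (swap p l)
Ascent⇒Descent-swap zero (x ∷ y ∷ l) x<y = x<y
Ascent⇒Descent-swap (suc p) (x ∷ l) asc = Ascent⇒Descent-swap p l asc

Descent⇒Ascent-swap : ∀ p l → Descent p l → Ascent p (swap p l)
Descent⇒Ascent-swap zero (x ∷ y ∷ l) y<x = y<x
Descent⇒Ascent-swap (suc p) (x ∷ l) des = Descent⇒Ascent-swap p l des

Ascent-bound : ∀ p l → Ascent p l → suc p < length l
Ascent-bound zero (x ∷ y ∷ l) _ = s≤s (s≤s z≤n)
Ascent-bound (suc p) (x ∷ l) asc = s≤s (Ascent-bound p l asc)

inversions-swap-ascent : ∀ p l → Ascent p l → inversions (swap p l) ≡ suc (inversions l)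
inversions-swap-ascent zero (x ∷ y ∷ l) x<y = begin
  inversions (y ∷ x ∷ l)    ≡⟨ inversions-∷∷-swap x y l ⟩
  less x y + R              ≡⟨ cong (_+ R) (less-< x<y) ⟩
  suc R                     ≡⟨ cong (λ t → suc (t + R)) (less-≥ (<⇒≤ x<y)) ⟨
  suc (less y x + R)        ≡⟨ cong suc (inversions-∷∷ x y l) ⟨
  suc (inversions (x ∷ y ∷ l)) ∎
  where
  open ≡-Reasoning
  R = smaller x l + (smaller y l + inversions l)
inversions-swap-ascent (suc p) (x ∷ l) asc = begin
  smaller x (swap p l) + inversions (swap p l)   ≡⟨ cong₂ _+_ (smaller-swap x p l) (inversions-swap-ascent p l asc) ⟩
  smaller x l + suc (inversions l)               ≡⟨ +-suc (smaller x l) (inversions l) ⟩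
  suc (smaller x l + inversions l)               ∎
  where open ≡-Reasoning

inversions-swap-descent : ∀ p l → Descent p l → inversions l ≡ suc (inversions (swap p l))
inversions-swap-descent p l des =
  trans (cong inversions (sym (swap-involutive p l))) (inversions-swap-ascent p (swap p l) (Descent⇒Ascent-swap p l des))

inversions-swap-¬ascent : ∀ p l → ¬ Ascent p l → inversions (swap p l) ≤ inversions l
inversions-swap-¬ascent zero [] _ = ≤-refl
inversions-swap-¬ascent zero (x ∷ []) _ = ≤-refl
inversions-swap-¬ascent zero (x ∷ y ∷ l) x≮y = begin
  inversions (y ∷ x ∷ l)                                  ≡⟨ inversions-∷∷-swap x y l ⟩
  less x y + (smaller x l + (smaller y l + inversions l))  ≤⟨ +-monoˡ-≤ _ (≤-trans (≤-reflexive (less-≥ (≮⇒≥ x≮y))) (z≤n {less y x})) ⟩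
  less y x + (smaller x l + (smaller y l + inversions l))  ≡⟨ inversions-∷∷ x y l ⟨
  inversions (x ∷ y ∷ l)                                  ∎
  where open ≤-Reasoning
inversions-swap-¬ascent (suc p) [] _ = ≤-refl
inversions-swap-¬ascent (suc p) (x ∷ l) ¬asc =
  ≤-trans (≤-reflexive (cong (_+ inversions (swap p l)) (smaller-swap x p l))) (+-monoʳ-≤ (smaller x l) (inversions-swap-¬ascent p l ¬asc))

inversions-swap-≤ : ∀ p l → inversions (swap p l) ≤ suc (inversions l)
inversions-swap-≤ p l with ascent? p l
... | yes asc = ≤-reflexive (inversions-swap-ascent p l asc)
... | no ¬asc = m≤n⇒m≤1+n (inversions-swap-¬ascent p l ¬asc)

inversions-act-≤ : ∀ w l → inversions (act w l) ≤ inversions l + length w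
inversions-act-≤ [] l = ≤-reflexive (sym (+-identityʳ _))
inversions-act-≤ (i ∷ w) l = begin
  inversions (act w (swap i l))           ≤⟨ inversions-act-≤ w (swap i l) ⟩
  inversions (swap i l) + length w        ≤⟨ +-monoˡ-≤ (length w) (inversions-swap-≤ i l) ⟩
  suc (inversions l) + length w           ≡⟨ +-suc (inversions l) (length w) ⟨
  inversions l + length (i ∷ w)           ∎
  where open ≤-Reasoning

perm : ℕ → BWord → List ℕ
perm n w = act w (upTo n)

Reduced : ℕ → BWord → Set
Reduced n w = inversions (perm n w) ≡ length w

length-perm : ∀ n w → length (perm n w) ≡ n
length-perm n w = trans (length-act w (upTo n)) (length-upTo n)

length-∷ʳ : ∀ (w : BWord) k → length (w ++ [ k ]) ≡ suc (length w)
length-∷ʳ w k = trans (length-++ w) (+-comm (length w) 1)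

smaller-zero : ∀ l → smaller 0 l ≡ 0
smaller-zero [] = refl
smaller-zero (zero ∷ l) = smaller-zero l
smaller-zero (suc y ∷ l) = smaller-zero l

smaller-map-suc : ∀ x l → smaller (suc x) (map suc l) ≡ smaller x l
smaller-map-suc x [] = refl
smaller-map-suc x (y ∷ l) = cong (less y x +_) (smaller-map-suc x l)

inversions-map-suc : ∀ l → inversions (map suc l) ≡ inversions l
inversions-map-suc [] = refl
inversions-map-suc (x ∷ l) = cong₂ _+_ (smaller-map-suc x l) (inversions-map-suc l)

upTo-suc : ∀ m → upTo (suc m) ≡ 0 ∷ map suc (upTo m)
upTo-suc m = cong (0 ∷_) (sym (map-upTo suc m))

inversions-upTo : ∀ n → inversions (upTo n) ≡ 0
inversions-upTo zero = refl
inversions-upTo (suc n) = trans (cong inversions (upTo-suc n))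
  (cong₂ _+_ (smaller-zero (map suc (upTo n))) (trans (inversions-map-suc (upTo n)) (inversions-upTo n)))

act-map-suc : ∀ w x l → act (map suc w) (x ∷ l) ≡ x ∷ act w l
act-map-suc [] x l = refl
act-map-suc (i ∷ w) x l = act-map-suc w x (swap i l)

act-upTo : ∀ (t r : List ℕ) x → act (upTo (length t)) (x ∷ t ++ r) ≡ t ++ x ∷ r
act-upTo [] r x = refl
act-upTo (y ∷ t) r x = begin
  act (upTo (suc (length t))) (x ∷ y ∷ t ++ r)     ≡⟨ cong (λ w → act w (x ∷ y ∷ t ++ r)) (upTo-suc (length t)) ⟩
  act (map suc (upTo (length t))) (y ∷ x ∷ t ++ r)  ≡⟨ act-map-suc (upTo (length t)) y (x ∷ t ++ r) ⟩
  y ∷ act (upTo (length t)) (x ∷ t ++ r)            ≡⟨ cong (y ∷_) (act-upTo t r x) ⟩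
  y ∷ t ++ x ∷ r                                    ∎
  where open ≡-Reasoning

act-Δ : ∀ (t r : List ℕ) → act (Δ (length t)) (t ++ r) ≡ reverse t ++ r
act-Δ [] r = refl
act-Δ (x ∷ t) r = begin
  act (upTo (length t) ++ Δ (length t)) (x ∷ t ++ r)         ≡⟨ act-++ (upTo (length t)) (Δ (length t)) (x ∷ t ++ r) ⟩
  act (Δ (length t)) (act (upTo (length t)) (x ∷ t ++ r))    ≡⟨ cong (act (Δ (length t))) (act-upTo t r x) ⟩
  act (Δ (length t)) (t ++ x ∷ r)                            ≡⟨ act-Δ t (x ∷ r) ⟩
  reverse t ++ x ∷ r                                         ≡⟨ ++-assoc (reverse t) [ x ] r ⟨
  (reverse t ++ [ x ]) ++ r                                  ≡⟨ cong (_++ r) (unfold-reverse x t) ⟨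
  reverse (x ∷ t) ++ r                                       ∎
  where open ≡-Reasoning

perm-Δ : ∀ n → perm n (Δ n) ≡ reverse (upTo n)
perm-Δ n = begin
  act (Δ n) (upTo n)                               ≡⟨ cong (λ m → act (Δ m) (upTo n)) (length-upTo n) ⟨
  act (Δ (length (upTo n))) (upTo n)               ≡⟨ cong (act (Δ (length (upTo n)))) (++-identityʳ (upTo n)) ⟨
  act (Δ (length (upTo n))) (upTo n ++ [])         ≡⟨ act-Δ (upTo n) [] ⟩
  reverse (upTo n) ++ []                           ≡⟨ ++-identityʳ _ ⟩
  reverse (upTo n)                                 ∎
  where open ≡-Reasoning

smaller-all : ∀ {x l} → All (_< x) l → smaller x l ≡ length l
smaller-all [] = refl
smaller-all (y<x ∷ l<x) = cong₂ _+_ (less-< y<x) (smaller-all l<x)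

reverse-upTo-suc : ∀ n → reverse (upTo (suc n)) ≡ n ∷ reverse (upTo n)
reverse-upTo-suc n = trans (cong reverse (sym (upTo-∷ʳ n))) (reverse-++ (upTo n) [ n ])

length-Δ-suc : ∀ n → length (Δ (suc n)) ≡ n + length (Δ n)
length-Δ-suc n = trans (length-++ (upTo n)) (cong (_+ length (Δ n)) (length-upTo n))

inversions-reverse-upTo : ∀ n → inversions (reverse (upTo n)) ≡ length (Δ n)
inversions-reverse-upTo zero = refl
inversions-reverse-upTo (suc n) = begin
  inversions (reverse (upTo (suc n)))                           ≡⟨ cong inversions (reverse-upTo-suc n) ⟩
  smaller n (reverse (upTo n)) + inversions (reverse (upTo n))  ≡⟨ cong₂ _+_ (smaller-all (All-reverse (upTo-< n))) (inversions-reverse-upTo n) ⟩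
  length (reverse (upTo n)) + length (Δ n)                      ≡⟨ cong (_+ length (Δ n)) (trans (length-reverse (upTo n)) (length-upTo n)) ⟩
  n + length (Δ n)                                              ≡⟨ length-Δ-suc n ⟨
  length (Δ (suc n))                                            ∎
  where open ≡-Reasoning

Reduced-Δ : ∀ n → Reduced n (Δ n)
Reduced-Δ n = trans (cong inversions (perm-Δ n)) (inversions-reverse-upTo n)

inversions-perm-≤ : ∀ n w → inversions (perm n w) ≤ length w
inversions-perm-≤ n w = subst (inversions (perm n w) ≤_) (cong (_+ length w) (inversions-upTo n)) (inversions-act-≤ w (upTo n))

Reduced-prefix : ∀ {n} w t → Reduced n (w ++ t) → Reduced n w
Reduced-prefix {n} w t wt-red = ≤-antisym (inversions-perm-≤ n w) (+-cancelʳ-≤ (length t) _ _ (begin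
  length w + length t                   ≡⟨ length-++ w ⟨
  length (w ++ t)                       ≡⟨ wt-red ⟨
  inversions (perm n (w ++ t))          ≡⟨ cong inversions (act-++ w t (upTo n)) ⟩
  inversions (act t (perm n w))         ≤⟨ inversions-act-≤ t (perm n w) ⟩
  inversions (perm n w) + length t      ∎))
  where open ≤-Reasoning

perm-≈ : ∀ {n u v} → IsWord n u → u ≈ v → perm n u ≡ perm n v
perm-≈ {n} {u} u-word u≈v = act-≈ u≈v (upTo n) (subst (λ m → IsWord m u) (sym (length-upTo n)) u-word)

Reduced-resp-≈ : ∀ {n u v} → IsWord n u → u ≈ v → Reduced n u → Reduced n v
Reduced-resp-≈ u-word u≈v u-red = trans (cong inversions (sym (perm-≈ u-word u≈v))) (trans u-red (≈⇒length≡ u≈v))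

Simple⇒Reduced : ∀ {n y} → Simple n y → Reduced n y
Simple⇒Reduced {n} {y} (_ , z , _ , yz≈Δ) = Reduced-prefix y z (Reduced-resp-≈ (Δ-isWord n) (≈-sym yz≈Δ) (Reduced-Δ n))

perm-∷ʳ : ∀ n w k → perm n (w ++ [ k ]) ≡ swap k (perm n w)
perm-∷ʳ n w k = act-++ w [ k ] (upTo n)

perm-≈∷ʳ : ∀ {n w w′ k} → IsWord n w → w ≈ w′ ++ [ k ] → perm n w′ ≡ swap k (perm n w)
perm-≈∷ʳ {n} {w} {w′} {k} w-word w≈ =
  trans (sym (swap-involutive k (perm n w′))) (cong (swap k) (trans (sym (perm-∷ʳ n w′ k)) (sym (perm-≈ w-word w≈))))

IsWord-≈∷ʳ : ∀ {n w w′ k} → IsWord n w → w ≈ w′ ++ [ k ] → IsWord n w′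
IsWord-≈∷ʳ {w′ = w′} w-word w≈ = AllP.++⁻ˡ w′ (All-resp-≈ w≈ w-word)

Reduced-≈∷ʳ : ∀ {n w w′ k} → IsWord n w → w ≈ w′ ++ [ k ] → Reduced n w → Reduced n w′
Reduced-≈∷ʳ {w′ = w′} {k} w-word w≈ w-red = Reduced-prefix w′ [ k ] (Reduced-resp-≈ w-word w≈ w-red)

length-≈∷ʳ : ∀ {w w′ : BWord} {k} → w ≈ w′ ++ [ k ] → length w′ < length w
length-≈∷ʳ {w′ = w′} {k} w≈ = ≤-reflexive (sym (trans (≈⇒length≡ w≈) (length-∷ʳ w′ k)))

Reduced-last-descent : ∀ {n} w k → Reduced n (w ++ [ k ]) → Descent k (perm n (w ++ [ k ]))
Reduced-last-descent {n} w k wk-red with ascent? k (perm n w)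
... | yes asc = subst (Descent k) (sym (perm-∷ʳ n w k)) (Ascent⇒Descent-swap k (perm n w) asc)
... | no ¬asc = contradiction (begin-strict
  length w                          <⟨ n<1+n (length w) ⟩
  suc (length w)                    ≡⟨ length-∷ʳ w k ⟨
  length (w ++ [ k ])               ≡⟨ wk-red ⟨
  inversions (perm n (w ++ [ k ]))  ≡⟨ cong inversions (perm-∷ʳ n w k) ⟩
  inversions (swap k (perm n w))    ≤⟨ inversions-swap-¬ascent k (perm n w) ¬asc ⟩
  inversions (perm n w)             ≤⟨ inversions-perm-≤ n w ⟩
  length w                          ∎) (<-irrefl refl)
  where open ≤-Reasoning

¬Descent-upTo : ∀ n {j} → ¬ Descent j (upTo n)
¬Descent-upTo n {j} des with trans (sym (inversions-upTo n)) (inversions-swap-descent j (upTo n) des)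
... | ()

Descent-swap-far : ∀ j k l → Far j k → Descent j (swap k l) → Descent j l
Descent-swap-far zero (suc (suc k)) (x ∷ y ∷ l) _ des = des
Descent-swap-far zero zero _ f _ = contradiction f Far-irrefl
Descent-swap-far zero (suc zero) _ (inj₁ (s≤s ())) _
Descent-swap-far zero (suc (suc k)) (x ∷ []) _ ()
Descent-swap-far (suc (suc j)) zero (x ∷ y ∷ l) _ des = des
Descent-swap-far (suc j) (suc k) (x ∷ l) (inj₁ (s≤s j+2≤k)) des = Descent-swap-far j k l (inj₁ j+2≤k) des
Descent-swap-far (suc j) (suc k) (x ∷ l) (inj₂ (s≤s k+2≤j)) des = Descent-swap-far j k l (inj₂ k+2≤j) des

Descent-adj : ∀ {j k} l → Adj j k → Descent j l → Descent k l → Descent j (swap k l) × Descent k (swap j (swap k l))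
Descent-adj {j} l (inj₁ refl) dj dk = run-swap-snd j l dj dk , run-swap-snd-fst j l dj dk
  where
  run-swap-snd : ∀ k l → Descent k l → Descent (suc k) l → Descent k (swap (suc k) l)
  run-swap-snd zero (x ∷ y ∷ z ∷ l) y<x z<y = <-trans z<y y<x
  run-swap-snd (suc k) (x ∷ l) d₁ d₂ = run-swap-snd k l d₁ d₂
  run-swap-snd-fst : ∀ k l → Descent k l → Descent (suc k) l → Descent (suc k) (swap k (swap (suc k) l))
  run-swap-snd-fst zero (x ∷ y ∷ z ∷ l) y<x _ = y<x
  run-swap-snd-fst (suc k) (x ∷ l) d₁ d₂ = run-swap-snd-fst k l d₁ d₂
Descent-adj {k = k} l (inj₂ refl) dj dk = run-swap-fst k l dk dj , run-swap-fst-snd k l dk dj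
  where
  run-swap-fst : ∀ k l → Descent k l → Descent (suc k) l → Descent (suc k) (swap k l)
  run-swap-fst zero (x ∷ y ∷ z ∷ l) y<x z<y = <-trans z<y y<x
  run-swap-fst (suc k) (x ∷ l) d₁ d₂ = run-swap-fst k l d₁ d₂
  run-swap-fst-snd : ∀ k l → Descent k l → Descent (suc k) l → Descent k (swap (suc k) (swap k l))
  run-swap-fst-snd zero (x ∷ y ∷ z ∷ l) _ z<y = z<y
  run-swap-fst-snd (suc k) (x ∷ l) d₁ d₂ = run-swap-fst-snd k l d₁ d₂

-- The exchange lemma, by induction on y = w k: a descent j far from k survives in w, and for j adjacent
-- to k, peeling first j and then k off w turns k into k j k = j k j.
descent⇒≼ʳBelow : ∀ N {n y j} → length y ≤ N → IsWord n y → Reduced n y → Descent j (perm n y) → [ j ] ≼ʳ y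
descent⇒≼ʳBelow N {n} {y} _ _ _ _ with initLast y
descent⇒≼ʳBelow N {n} {j = j} _ _ _ des | [] = contradiction des (¬Descent-upTo n {j})
descent⇒≼ʳBelow zero y≤0 _ _ _ | w ∷ʳ′ k = contradiction (subst (_≤ 0) (length-∷ʳ w k) y≤0) λ ()
descent⇒≼ʳBelow (suc N) {n} {j = j} y≤N y-word y-red des | w ∷ʳ′ k = exchange (letterRel j k)
  where
  w≤N : length w ≤ N
  w≤N = ≤-pred (subst (_≤ suc N) (length-∷ʳ w k) y≤N)
  w-word : IsWord n w
  w-word = AllP.++⁻ˡ w y-word
  w-red : Reduced n w
  w-red = Reduced-prefix w [ k ] y-red
  perm-w : perm n w ≡ swap k (perm n (w ++ [ k ]))
  perm-w = perm-≈∷ʳ {w′ = w} y-word ≈-refl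
  exchange : LetterRel j k → [ j ] ≼ʳ w ++ [ k ]
  exchange (equal refl) = w , ≈-refl
  exchange (far f) =
    let w′ , w≈ = descent⇒≼ʳBelow N w≤N w-word w-red (Descent-swap-far j k (perm n w) f (subst (Descent j) (perm-∷ʳ n w k) des))
    in w′ ++ [ k ] , (++⁺ʳ [ k ] w≈ ⨾ ++-assoc-≈ w′ [ j ] [ k ] ⨾ ≈-comm w′ [] j k f ⨾ ≈-sym (++-assoc-≈ w′ [ k ] [ j ]))
  exchange (adjacent a) =
    let dj , dk = Descent-adj (perm n (w ++ [ k ])) a des (Reduced-last-descent w k y-red)
        w₂ , w≈ = descent⇒≼ʳBelow N w≤N w-word w-red (subst (Descent j) (sym perm-w) dj)
        w₃ , w₂≈ = descent⇒≼ʳBelow N (≤-trans (<⇒≤ (length-≈∷ʳ w≈)) w≤N) (IsWord-≈∷ʳ w-word w≈) (Reduced-≈∷ʳ w-word w≈ w-red)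
                     (subst (Descent k) (sym (trans (perm-≈∷ʳ w-word w≈) (cong (swap j) perm-w))) dk)
    in w₃ ++ j ∷ k ∷ [] , (begin
      w ++ [ k ]                       ≈⟨ ++⁺ʳ [ k ] (w≈ ⨾ ++⁺ʳ [ j ] w₂≈) ⟩
      ((w₃ ++ [ k ]) ++ [ j ]) ++ [ k ] ≡⟨ trans (++-assoc (w₃ ++ [ k ]) [ j ] [ k ]) (++-assoc w₃ [ k ] (j ∷ k ∷ [])) ⟩
      w₃ ++ k ∷ j ∷ k ∷ []             ≈⟨ ≈-braid w₃ [] k j (Adj-sym a) ⟩
      w₃ ++ j ∷ k ∷ j ∷ []             ≡⟨ ++-assoc w₃ (j ∷ k ∷ []) [ j ] ⟨
      (w₃ ++ j ∷ k ∷ []) ++ [ j ]      ∎)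
    where open ≈-Reasoning

descent⇒≼ʳ : ∀ {n y j} → IsWord n y → Reduced n y → Descent j (perm n y) → [ j ] ≼ʳ y
descent⇒≼ʳ {y = y} = descent⇒≼ʳBelow (length y) ≤-refl

Reduced-identity : ∀ {n} u → Reduced n u → perm n u ≡ upTo n → u ≡ []
Reduced-identity [] _ _ = refl
Reduced-identity {n} (_ ∷ _) u-red perm≡ with trans (sym u-red) (trans (cong inversions perm≡) (inversions-upTo n))
... | ()

-- Matsumoto's theorem: the last letter of v is a descent of perm u, so the exchange lemma peels it off u.
matsumotoBelow : ∀ N {n u v} → length u < N → IsWord n u → IsWord n v → Reduced n u → Reduced n v → perm n u ≡ perm n v → u ≈ v
matsumotoBelow zero () _ _ _ _ _
matsumotoBelow (suc N) {v = v} _ _ _ _ _ _ with initLast v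
matsumotoBelow (suc N) {u = u} _ _ _ u-red _ perm≡ | [] = ≡⇒≈ (Reduced-identity u u-red perm≡)
matsumotoBelow (suc N) {n} {u} u<N u-word v-word u-red v-red perm≡ | v′ ∷ʳ′ b
  with descent⇒≼ʳ u-word u-red (subst (Descent b) (sym perm≡) (Reduced-last-descent v′ b v-red))
... | x , u≈ = u≈ ⨾ ++⁺ʳ [ b ] (matsumotoBelow N (≤-trans (length-≈∷ʳ u≈) (≤-pred u<N)) (IsWord-≈∷ʳ u-word u≈) (AllP.++⁻ˡ v′ v-word)
                                   (Reduced-≈∷ʳ u-word u≈ u-red) (Reduced-prefix v′ [ b ] v-red) perm-x≡)
  where
  perm-x≡ : perm n x ≡ perm n v′
  perm-x≡ = trans (perm-≈∷ʳ u-word u≈) (trans (cong (swap b) perm≡) (sym (perm-≈∷ʳ {w′ = v′} v-word ≈-refl)))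

matsumoto : ∀ {n u v} → IsWord n u → IsWord n v → Reduced n u → Reduced n v → perm n u ≡ perm n v → u ≈ v
matsumoto {u = u} = matsumotoBelow (suc (length u)) ≤-refl

All-swap : ∀ {P : ℕ → Set} p l → All P l → All P (swap p l)
All-swap zero [] h = h
All-swap zero (x ∷ []) h = h
All-swap zero (x ∷ y ∷ l) (px ∷ py ∷ pl) = py ∷ px ∷ pl
All-swap (suc p) [] h = h
All-swap (suc p) (x ∷ l) (px ∷ pl) = px ∷ All-swap p l pl

All-act : ∀ {P : ℕ → Set} w l → All P l → All P (act w l)
All-act [] l h = h
All-act (i ∷ w) l h = All-act w (swap i l) (All-swap i l h)

Unique-swap : ∀ p l → Unique l → Unique (swap p l)
Unique-swap zero [] u = u
Unique-swap zero (x ∷ []) u = u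
Unique-swap zero (x ∷ y ∷ l) ((x≢y ∷ x∉l) ∷ y∉l ∷ l-unique) = (≢-sym x≢y ∷ y∉l) ∷ x∉l ∷ l-unique
Unique-swap (suc p) [] u = u
Unique-swap (suc p) (x ∷ l) (x∉l ∷ l-unique) = All-swap p l x∉l ∷ Unique-swap p l l-unique

Unique-act : ∀ w l → Unique l → Unique (act w l)
Unique-act [] l u = u
Unique-act (i ∷ w) l u = Unique-act w (swap i l) (Unique-swap i l u)

Unique-perm : ∀ n w → Unique (perm n w)
Unique-perm n w = Unique-act w (upTo n) (Unique.upTo⁺ n)

perm-< : ∀ n w → All (_< n) (perm n w)
perm-< n w = All-act w (upTo n) (upTo-< n)

Decreasing : List ℕ → Set
Decreasing = AllPairs _>_

ascent-or-decreasing : ∀ l → Unique l → (Σ ℕ λ p → Ascent p l) ⊎ Decreasing l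
ascent-or-decreasing [] _ = inj₂ []
ascent-or-decreasing (x ∷ []) _ = inj₂ ([] ∷ [])
ascent-or-decreasing (x ∷ y ∷ l) ((x≢y ∷ _) ∷ yl-unique) with x <? y | ascent-or-decreasing (y ∷ l) yl-unique
... | yes x<y | _ = inj₁ (0 , x<y)
... | no _ | inj₁ (p , asc) = inj₁ (suc p , asc)
... | no x≮y | inj₂ (y>l ∷ l-dec) = inj₂ ((y<x ∷ All.map (λ z<y → <-trans z<y y<x) y>l) ∷ y>l ∷ l-dec)
  where
  y<x : y < x
  y<x = ≤∧≢⇒< (≮⇒≥ x≮y) (≢-sym x≢y)

Decreasing-length : ∀ {x l} → Decreasing (x ∷ l) → length l ≤ x
Decreasing-length {l = []} _ = z≤n
Decreasing-length {l = y ∷ l} ((y<x ∷ _) ∷ dec) = ≤-trans (s≤s (Decreasing-length dec)) y<x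

Decreasing⇒reverse-upTo : ∀ {m l} → Decreasing l → length l ≡ m → All (_< m) l → l ≡ reverse (upTo m)
Decreasing⇒reverse-upTo {zero} {[]} _ _ _ = refl
Decreasing⇒reverse-upTo {suc m} {x ∷ l} (x>l ∷ l-dec) len≡ (x<m ∷ _)
  with ≤-antisym (≤-pred x<m) (subst (_≤ x) (suc-injective len≡) (Decreasing-length (x>l ∷ l-dec)))
... | refl = trans (cong (x ∷_) (Decreasing⇒reverse-upTo l-dec (suc-injective len≡) x>l)) (sym (reverse-upTo-suc x))

smaller-≤ : ∀ x l → smaller x l ≤ length l
smaller-≤ x [] = z≤n
smaller-≤ x (y ∷ l) = +-mono-≤ (less≤1 y x) (smaller-≤ x l)

inversions-≤ : ∀ l → inversions l ≤ length (Δ (length l))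
inversions-≤ [] = z≤n
inversions-≤ (x ∷ l) = ≤-trans (+-mono-≤ (smaller-≤ x l) (inversions-≤ l)) (≤-reflexive (sym (length-Δ-suc (length l))))

Reduced-∷ʳ-ascent : ∀ {n w p} → Reduced n w → Ascent p (perm n w) → Reduced n (w ++ [ p ])
Reduced-∷ʳ-ascent {n} {w} {p} w-red asc = begin
  inversions (perm n (w ++ [ p ]))   ≡⟨ cong inversions (perm-∷ʳ n w p) ⟩
  inversions (swap p (perm n w))     ≡⟨ inversions-swap-ascent p (perm n w) asc ⟩
  suc (inversions (perm n w))        ≡⟨ cong suc w-red ⟩
  suc (length w)                     ≡⟨ length-∷ʳ w p ⟨
  length (w ++ [ p ])                ∎
  where open ≡-Reasoning

-- Appending ascents of the permutation keeps a word reduced; this ends at the longest permutation, i.e. at Δ.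
Reduced⇒≼ΔBelow : ∀ N {n w} → length (Δ n) ≤ length w + N → IsWord n w → Reduced n w → LDiv n w (Δ n)
Reduced⇒≼ΔBelow N {n} {w} _ w-word w-red with ascent-or-decreasing (perm n w) (Unique-perm n w)
... | inj₂ dec = [] , [] , (≡⇒≈ (++-identityʳ w) ⨾ matsumoto w-word (Δ-isWord n) w-red (Reduced-Δ n) perm≡)
  where
  perm≡ : perm n w ≡ perm n (Δ n)
  perm≡ = trans (Decreasing⇒reverse-upTo dec (length-perm n w) (perm-< n w)) (sym (perm-Δ n))
Reduced⇒≼ΔBelow zero {n} {w} Δ≤w _ w-red | inj₁ (p , asc) = contradiction (begin-strict
  length w                                      <⟨ n<1+n (length w) ⟩
  suc (length w)                                ≡⟨ length-∷ʳ w p ⟨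
  length (w ++ [ p ])                           ≡⟨ Reduced-∷ʳ-ascent {n} {w} w-red asc ⟨
  inversions (perm n (w ++ [ p ]))              ≤⟨ inversions-≤ (perm n (w ++ [ p ])) ⟩
  length (Δ (length (perm n (w ++ [ p ]))))     ≡⟨ cong (λ m → length (Δ m)) (length-perm n (w ++ [ p ])) ⟩
  length (Δ n)                                  ≤⟨ Δ≤w ⟩
  length w + 0                                  ≡⟨ +-identityʳ (length w) ⟩
  length w                                      ∎) (<-irrefl refl)
  where open ≤-Reasoning
Reduced⇒≼ΔBelow (suc N) {n} {w} Δ≤w w-word w-red | inj₁ (p , asc) =
  let t , t-word , wpt≈Δ = Reduced⇒≼ΔBelow N Δ≤wp (AllP.++⁺ w-word (p<n ∷ [])) (Reduced-∷ʳ-ascent {n} {w} w-red asc)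
  in p ∷ t , p<n ∷ t-word , (≈-sym (++-assoc-≈ w [ p ] t) ⨾ wpt≈Δ)
  where
  p<n : suc p < n
  p<n = subst (suc p <_) (length-perm n w) (Ascent-bound p (perm n w) asc)
  Δ≤wp : length (Δ n) ≤ length (w ++ [ p ]) + N
  Δ≤wp = ≤-trans Δ≤w (≤-reflexive (trans (+-suc (length w) N) (cong (_+ N) (sym (length-∷ʳ w p)))))

Reduced⇒≼Δ : ∀ {n w} → IsWord n w → Reduced n w → LDiv n w (Δ n)
Reduced⇒≼Δ {n} {w} = Reduced⇒≼ΔBelow (length (Δ n)) (m≤n+m (length (Δ n)) (length w))

¬Descent⇒Ascent : ∀ j l → Unique l → suc j < length l → ¬ Descent j l → Ascent j l
¬Descent⇒Ascent zero (x ∷ y ∷ l) ((x≢y ∷ _) ∷ _) _ ¬des = ≤∧≢⇒< (≮⇒≥ ¬des) x≢y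
¬Descent⇒Ascent zero (x ∷ []) _ (s≤s ()) _
¬Descent⇒Ascent (suc j) (x ∷ l) (_ ∷ l-unique) (s≤s j<l) ¬des = ¬Descent⇒Ascent j l l-unique j<l ¬des

Simple-∷ʳ-or-≼ʳ : ∀ {n y j} → Simple n y → suc j < n → LDiv n (y ++ [ j ]) (Δ n) ⊎ [ j ] ≼ʳ y
Simple-∷ʳ-or-≼ʳ {n} {y} {j} y-simple@(y-word , _) j<n with descent? j (perm n y)
... | yes des = inj₂ (descent⇒≼ʳ y-word (Simple⇒Reduced y-simple) des)
... | no ¬des = inj₁ (Reduced⇒≼Δ (AllP.++⁺ y-word (j<n ∷ [])) (Reduced-∷ʳ-ascent {n} {y} (Simple⇒Reduced y-simple) asc))
  where
  asc : Ascent j (perm n y)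
  asc = ¬Descent⇒Ascent j (perm n y) (Unique-perm n y) (subst (suc j <_) (sym (length-perm n y)) j<n) ¬des

Δ-squarefree : ∀ {n} u k v → ¬ (u ++ k ∷ k ∷ v ≈ Δ n)
Δ-squarefree {n} u k v ukkv≈Δ = contradiction (begin-strict
  length (u ++ v)                          <⟨ <-trans (n<1+n _) (n<1+n _) ⟩
  suc (suc (length (u ++ v)))              ≡⟨ trans (length-++-sucʳ u k (k ∷ v)) (cong suc (length-++-sucʳ u k v)) ⟨
  length (u ++ k ∷ k ∷ v)                  ≡⟨ Reduced-resp-≈ (Δ-isWord n) (≈-sym ukkv≈Δ) (Reduced-Δ n) ⟨
  inversions (perm n (u ++ k ∷ k ∷ v))     ≡⟨ cong inversions perm≡ ⟩
  inversions (perm n (u ++ v))             ≤⟨ inversions-perm-≤ n (u ++ v) ⟩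
  length (u ++ v)                          ∎) (<-irrefl refl)
  where
  open ≤-Reasoning
  perm≡ : perm n (u ++ k ∷ k ∷ v) ≡ perm n (u ++ v)
  perm≡ = trans (act-++ u (k ∷ k ∷ v) (upTo n))
                (trans (cong (act v) (swap-involutive k (perm n u))) (sym (act-++ u v (upTo n))))

-- Left-weighted normal form

concat-∷-++ : ∀ x xs zs → concat (x ∷ xs ++ zs) ≈ (x ++ concat xs) ++ concat zs
concat-∷-++ x xs zs = ≡⇒≈ (trans (cong (x ++_) (sym (concat-++ xs zs))) (sym (++-assoc x (concat xs) (concat zs))))

concat-singleton : ∀ y → concat [ y ] ≈ y
concat-singleton y = ≡⇒≈ (++-identityʳ y)

concat-pair : ∀ y D → concat (y ∷ D ∷ []) ≈ y ++ D
concat-pair y D = ++⁺ˡ y (concat-singleton D)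

module _ {n : ℕ} where

  LDiv-resp-≈ʳ : ∀ {x y y′} → y ≈ y′ → LDiv n x y → LDiv n x y′
  LDiv-resp-≈ʳ y≈ (z , z-word , xz≈) = z , z-word , (xz≈ ⨾ y≈)

  LDiv-resp-≈ˡ : ∀ {x x′ y} → x ≈ x′ → LDiv n x y → LDiv n x′ y
  LDiv-resp-≈ˡ x≈ (z , z-word , xz≈) = z , z-word , (++⁺ʳ z (≈-sym x≈) ⨾ xz≈)

  LDiv-of : ∀ {x y z} → IsWord n y → x ++ z ≈ y → LDiv n x y
  LDiv-of {x} y-word xz≈y = _ , AllP.++⁻ʳ x (All-resp-≈ (≈-sym xz≈y) y-word) , xz≈y

  LDiv⇒IsWord : ∀ {x y} → IsWord n y → LDiv n x y → IsWord n x
  LDiv⇒IsWord {x} y-word (_ , _ , xz≈y) = AllP.++⁻ˡ x (All-resp-≈ (≈-sym xz≈y) y-word)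

  LDiv-++ : ∀ {x y} c → IsWord n c → LDiv n x y → LDiv n x (y ++ c)
  LDiv-++ {x} c c-word (z , z-word , xz≈y) = z ++ c , AllP.++⁺ z-word c-word , (≈-sym (++-assoc-≈ x z c) ⨾ ++⁺ʳ c xz≈y)

  ¬∷ʳ-LDiv-self : ∀ y j → ¬ LDiv n (y ++ [ j ]) y
  ¬∷ʳ-LDiv-self y j (z , _ , yjz≈y) = 1+n≰n (begin
    suc (length y)                  ≡⟨ length-∷ʳ y j ⟨
    length (y ++ [ j ])             ≤⟨ m≤m+n _ _ ⟩
    length (y ++ [ j ]) + length z  ≡⟨ length-++ (y ++ [ j ]) ⟨
    length ((y ++ [ j ]) ++ z)      ≡⟨ ≈⇒length≡ yjz≈y ⟩
    length y                        ∎)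
    where open ≤-Reasoning

  IsLGcd-resp-≈ : ∀ {g a b g′ a′ b′} → g ≈ g′ → a ≈ a′ → b ≈ b′ → IsLGcd n g a b → IsLGcd n g′ a′ b′
  IsLGcd-resp-≈ g≈ a≈ b≈ (g≼a , g≼b , greatest) =
    LDiv-resp-≈ˡ g≈ (LDiv-resp-≈ʳ a≈ g≼a) , LDiv-resp-≈ˡ g≈ (LDiv-resp-≈ʳ b≈ g≼b) ,
    λ c c-word c≼a c≼b → LDiv-resp-≈ʳ g≈ (greatest c c-word (LDiv-resp-≈ʳ (≈-sym a≈) c≼a) (LDiv-resp-≈ʳ (≈-sym b≈) c≼b))

  Simple-resp-≈ : ∀ {x x′} → x ≈ x′ → Simple n x → Simple n x′
  Simple-resp-≈ x≈ (x-word , x≼Δ) = All-resp-≈ x≈ x-word , LDiv-resp-≈ˡ x≈ x≼Δ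

  Simple⇒IsLGcd-self : ∀ {x} → Simple n x → IsLGcd n x (Δ n) (x ++ [])
  Simple⇒IsLGcd-self {x} (_ , x≼Δ) = x≼Δ , ([] , [] , ≈-refl) , λ c _ _ c≼x → LDiv-resp-≈ʳ (≡⇒≈ (++-identityʳ x)) c≼x

  -- Δ-quasicentrality bounds the lcm of a and c by a Δ, so its a-complement is a simple divisor of y D, hence of y.
  IsLGcd-Δ-absorbs : ∀ {a y D c} → IsWord n a → IsWord n (y ++ D) → IsLGcd n y (Δ n) (y ++ D) →
                     IsWord n c → LDiv n c (Δ n) → LDiv n c (a ++ (y ++ D)) → LDiv n c (a ++ y)
  IsLGcd-Δ-absorbs {a} {y} {D} {c} a-word yD-word (_ , _ , greatest) _ (r , _ , cr≈Δ) (z , _ , cz≈ayD) =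
    LDiv-of (AllP.++⁺ a-word (AllP.++⁻ˡ y yD-word)) (begin
      c ++ v⁺ L ++ t          ≈⟨ ++-assoc-≈ c (v⁺ L) t ⟨
      (c ++ v⁺ L) ++ t        ≈⟨ ++⁺ʳ t (common L) ⟨
      (a ++ u⁺ L) ++ t        ≈⟨ ++-assoc-≈ a (u⁺ L) t ⟩
      a ++ u⁺ L ++ t          ≈⟨ ++⁺ˡ a u⁺t≈y ⟩
      a ++ y                  ∎)
    where
    open ≈-Reasoning
    L = rightLcm {a} {c} (≈-sym cz≈ayD)
    b = proj₁ (Δ-quasiCentral a-word)
    aΔ≈crb : a ++ Δ n ≈ c ++ r ++ b
    aΔ≈crb = proj₂ (Δ-quasiCentral a-word) ⨾ ++⁺ʳ b (≈-sym cr≈Δ) ⨾ ++-assoc-≈ c r b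
    u⁺≼yD : LDiv n (u⁺ L) (y ++ D)
    u⁺≼yD = LDiv-of yD-word (≈-sym (proj₁ (proj₂ (least L (y ++ D) z (≈-sym cz≈ayD)))))
    u⁺≼Δ : LDiv n (u⁺ L) (Δ n)
    u⁺≼Δ = LDiv-of (Δ-isWord n) (≈-sym (proj₁ (proj₂ (least L (Δ n) (r ++ b) aΔ≈crb))))
    u⁺≼y : LDiv n (u⁺ L) y
    u⁺≼y = greatest (u⁺ L) (LDiv⇒IsWord yD-word u⁺≼yD) u⁺≼Δ u⁺≼yD
    t = proj₁ u⁺≼y
    u⁺t≈y : u⁺ L ++ t ≈ y
    u⁺t≈y = proj₂ (proj₂ u⁺≼y)

  IsLGcd-Δ-++⁺ : ∀ {a y D g} → IsWord n a → IsWord n (y ++ D) → IsLGcd n y (Δ n) (y ++ D) →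
                 IsLGcd n g (Δ n) (a ++ y) → IsLGcd n g (Δ n) (a ++ (y ++ D))
  IsLGcd-Δ-++⁺ {a} {y} {D} a-word yD-word y-gcd (g≼Δ , g≼ay , greatest) =
    g≼Δ , LDiv-resp-≈ʳ (++-assoc-≈ a y D) (LDiv-++ D (AllP.++⁻ʳ y yD-word) g≼ay) ,
    λ c c-word c≼Δ c≼ayD → greatest c c-word c≼Δ (IsLGcd-Δ-absorbs a-word yD-word y-gcd c-word c≼Δ c≼ayD)

  IsLGcd-Δ-++⁻ : ∀ {a y D g} → IsWord n a → IsWord n (y ++ D) → IsLGcd n y (Δ n) (y ++ D) →
                 IsLGcd n g (Δ n) (a ++ (y ++ D)) → IsLGcd n g (Δ n) (a ++ y)
  IsLGcd-Δ-++⁻ {a} {y} {D} a-word yD-word y-gcd (g≼Δ , g≼ayD , greatest) =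
    g≼Δ , IsLGcd-Δ-absorbs a-word yD-word y-gcd (LDiv⇒IsWord (Δ-isWord n) g≼Δ) g≼Δ g≼ayD ,
    λ c c-word c≼Δ c≼ay → greatest c c-word c≼Δ (LDiv-resp-≈ʳ (++-assoc-≈ a y D) (LDiv-++ D (AllP.++⁻ʳ y yD-word) c≼ay))

  Normal⇒IsWord-concat : ∀ {zs} → Normal n zs → IsWord n (concat zs)
  Normal⇒IsWord-concat {[]} _ = []
  Normal⇒IsWord-concat {_ ∷ _} ((x-word , _) , _ , zs-normal) = AllP.++⁺ x-word (Normal⇒IsWord-concat zs-normal)

  Normal-++⁻ʳ : ∀ xs {ys} → Normal n (xs ++ ys) → Normal n ys
  Normal-++⁻ʳ [] ys-normal = ys-normal
  Normal-++⁻ʳ (_ ∷ xs) (_ , _ , rest) = Normal-++⁻ʳ xs rest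

  Normal-∷ʳ⁻ : ∀ xs {y D} → IsWord n (y ++ D) → IsLGcd n y (Δ n) (y ++ D) →
               Normal n (xs ++ y ∷ D ∷ []) → Normal n (xs ++ [ y ])
  Normal-∷ʳ⁻ [] _ _ (y-simple , _ , _) = y-simple , Simple⇒IsLGcd-self y-simple , tt
  Normal-∷ʳ⁻ (x ∷ xs) {y} {D} yD-word y-gcd (x-simple , x-gcd , rest) =
    x-simple ,
    IsLGcd-resp-≈ ≈-refl ≈-refl (≈-sym (concat-∷-++ x xs [ y ] ⨾ ++⁺ˡ a (concat-singleton y)))
      (IsLGcd-Δ-++⁻ a-word yD-word y-gcd
        (IsLGcd-resp-≈ ≈-refl ≈-refl (concat-∷-++ x xs (y ∷ D ∷ []) ⨾ ++⁺ˡ a (concat-pair y D)) x-gcd)) ,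
    Normal-∷ʳ⁻ xs yD-word y-gcd rest
    where
    a = x ++ concat xs
    a-word : IsWord n a
    a-word = AllP.++⁻ˡ a (All-resp-≈ (concat-∷-++ x xs (y ∷ D ∷ [])) (Normal⇒IsWord-concat (x-simple , x-gcd , rest)))

  Normal-∷ʳ⁺ : ∀ xs {y D} → IsWord n (y ++ D) → Simple n D → IsLGcd n y (Δ n) (y ++ D) →
               Normal n (xs ++ [ y ]) → Normal n (xs ++ y ∷ D ∷ [])
  Normal-∷ʳ⁺ [] {y} {D} _ D-simple y-gcd (y-simple , _ , _) =
    y-simple , IsLGcd-resp-≈ ≈-refl ≈-refl (≈-sym ((concat-pair y D))) y-gcd , D-simple , Simple⇒IsLGcd-self D-simple , tt
  Normal-∷ʳ⁺ (x ∷ xs) {y} {D} yD-word D-simple y-gcd (x-simple , x-gcd , rest) =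
    x-simple ,
    IsLGcd-resp-≈ ≈-refl ≈-refl (≈-sym (concat-∷-++ x xs (y ∷ D ∷ []) ⨾ ++⁺ˡ a (concat-pair y D)))
      (IsLGcd-Δ-++⁺ a-word yD-word y-gcd
        (IsLGcd-resp-≈ ≈-refl ≈-refl (concat-∷-++ x xs [ y ] ⨾ ++⁺ˡ a (concat-singleton y)) x-gcd)) ,
    Normal-∷ʳ⁺ xs yD-word D-simple y-gcd rest
    where
    a = x ++ concat xs
    a-word : IsWord n a
    a-word = AllP.++⁻ˡ a (All-resp-≈ (concat-∷-++ x xs [ y ]) (Normal⇒IsWord-concat (x-simple , x-gcd , rest)))

  RDiv⇒≼ʳ : ∀ {x y} → RDiv n x y → x ≼ʳ y
  RDiv⇒≼ʳ (z , _ , zx≈y) = z , ≈-sym zx≈y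

  ≼ʳ⇒RDiv : ∀ {x y} → IsWord n y → x ≼ʳ y → RDiv n x y
  ≼ʳ⇒RDiv {x} y-word (z , y≈zx) = z , AllP.++⁻ˡ z (All-resp-≈ y≈zx y-word) , ≈-sym y≈zx

  Simple-Δ : ∀ {m} → m ≤ n → Simple n (Δ m)
  Simple-Δ {m} m≤n = IsWord-mono m≤n (Δ-isWord m) , LDiv-of (Δ-isWord n) (≈-sym (proj₂ (Δ-≼ m≤n)))

  -- Δ m j = j′ Δ m and Δ m starts with j′, so y j would contain the square j′ j′.
  ∷ʳ-¬≼Δ : ∀ {m y j} → Δ m ≼ʳ y → suc j < m → ¬ (y ++ [ j ] ≼ Δ n)
  ∷ʳ-¬≼Δ {m} {y} {j} (y₀ , y≈) j<m (R , Δ≈) = Δ-squarefree {n} y₀ j′ (e ++ R) (≈-sym (begin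
    Δ n                             ≈⟨ Δ≈ ⟩
    (y ++ [ j ]) ++ R               ≈⟨ ++⁺ʳ R (++⁺ʳ [ j ] y≈) ⟩
    ((y₀ ++ Δ m) ++ [ j ]) ++ R     ≡⟨ reassoc ⟩
    y₀ ++ (Δ m ++ [ j ]) ++ R       ≈⟨ ++⁺ˡ y₀ (++⁺ʳ R Δj≈) ⟨
    y₀ ++ j′ ∷ Δ m ++ R             ≈⟨ ++⁺ˡ y₀ (∷⁺ j′ (++⁺ʳ R Δm≈)) ⟩
    y₀ ++ j′ ∷ j′ ∷ e ++ R          ∎))
    where
    open ≈-Reasoning
    j′ = proj₁ (Δ-conj-letterʳ j<m)
    Δj≈ : j′ ∷ Δ m ≈ Δ m ++ [ j ]
    Δj≈ = proj₂ (proj₂ (Δ-conj-letterʳ j<m))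
    e = proj₁ (letter≼Δ (proj₁ (proj₂ (Δ-conj-letterʳ j<m))))
    Δm≈ : Δ m ≈ j′ ∷ e
    Δm≈ = proj₂ (letter≼Δ (proj₁ (proj₂ (Δ-conj-letterʳ j<m))))
    reassoc : ((y₀ ++ Δ m) ++ [ j ]) ++ R ≡ y₀ ++ (Δ m ++ [ j ]) ++ R
    reassoc = trans (++-assoc (y₀ ++ Δ m) [ j ] R)
                (trans (++-assoc y₀ (Δ m) (j ∷ R)) (cong (y₀ ++_) (sym (++-assoc (Δ m) [ j ] R))))

  IsLGcd-Δ⇒Δ≼ʳ : ∀ {m y} → m ≤ n → Simple n y → IsLGcd n y (Δ n) (y ++ Δ m) → Δ m ≼ʳ y
  IsLGcd-Δ⇒Δ≼ʳ {m} {y} m≤n y-simple (_ , _ , greatest) = Δ-lcmʳ m letter≼ʳy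
    where
    letter≼ʳy : ∀ {j} → suc j < m → [ j ] ≼ʳ y
    letter≼ʳy {j} j<m with Simple-∷ʳ-or-≼ʳ y-simple (≤-trans j<m m≤n)
    ... | inj₂ j≼ʳy = j≼ʳy
    ... | inj₁ yj≼Δ = contradiction (greatest (y ++ [ j ]) (LDiv⇒IsWord (Δ-isWord n) yj≼Δ) yj≼Δ yj≼yΔm) (¬∷ʳ-LDiv-self y j)
      where
      e = proj₁ (letter≼Δ j<m)
      yj≼yΔm : LDiv n (y ++ [ j ]) (y ++ Δ m)
      yj≼yΔm = LDiv-of (AllP.++⁺ (proj₁ y-simple) (IsWord-mono m≤n (Δ-isWord m)))
                       (++-assoc-≈ y [ j ] e ⨾ ++⁺ˡ y (≈-sym (proj₂ (letter≼Δ j<m))))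

  Δ≼ʳ⇒IsLGcd-Δ : ∀ {m y} → m ≤ n → Simple n y → Δ m ≼ʳ y → IsLGcd n y (Δ n) (y ++ Δ m)
  Δ≼ʳ⇒IsLGcd-Δ {m} {y} m≤n (y-word , ȳ , ȳ-word , yȳ≈Δ) Δm≼ʳy =
    (ȳ , ȳ-word , yȳ≈Δ) , (Δ m , IsWord-mono m≤n (Δ-isWord m) , ≈-refl) , greatest
    where
    greatest : ∀ c → IsWord n c → LDiv n c (Δ n) → LDiv n c (y ++ Δ m) → LDiv n c y
    greatest c _ (r , _ , cr≈Δ) (z , _ , cz≈yΔm) =
      c≼y (u⁺ L) (proj₁ (proj₂ (least L (Δ m) z (≈-sym cz≈yΔm)))) (proj₁ (proj₂ (least L ȳ r (yȳ≈Δ ⨾ ≈-sym cr≈Δ)))) (common L)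
      where
      L = rightLcm {y} {c} (≈-sym cz≈yΔm)
      -- the complement of y in lcm(y, c) left-divides both Δ m and ȳ; a first letter j would make y j simple
      c≼y : ∀ v {z₁ z₂} → Δ m ≈ v ++ z₁ → ȳ ≈ v ++ z₂ → y ++ v ≈ c ++ v⁺ L → LDiv n c y
      c≼y [] _ _ y≈ = LDiv-of y-word (≈-sym y≈ ⨾ ≡⇒≈ (++-identityʳ y))
      c≼y (j ∷ v) {z₂ = z₂} Δm≈ ȳ≈ _ = contradiction yj≼Δ (∷ʳ-¬≼Δ Δm≼ʳy j<m)
        where
        j<m : suc j < m
        j<m = All.head (All-resp-≈ Δm≈ (Δ-isWord m))
        yj≼Δ : y ++ [ j ] ≼ Δ n
        yj≼Δ = v ++ z₂ , (≈-sym yȳ≈Δ ⨾ ++⁺ˡ y ȳ≈ ⨾ ≈-sym (++-assoc-≈ y [ j ] (v ++ z₂)))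

Normal-∷ʳ-Δ⁻ : ∀ {n m} xs {y} → m ≤ n → Normal n (xs ++ y ∷ Δ m ∷ []) → Normal n (xs ++ [ y ]) × RDiv n (Δ m) y
Normal-∷ʳ-Δ⁻ {n} {m} xs {y} m≤n normal =
  Normal-∷ʳ⁻ xs (AllP.++⁺ (proj₁ y-simple) (proj₁ Δm-simple)) y-gcd normal ,
  ≼ʳ⇒RDiv (proj₁ y-simple) (IsLGcd-Δ⇒Δ≼ʳ m≤n y-simple y-gcd)
  where
  y-simple = proj₁ (Normal-++⁻ʳ xs normal)
  Δm-simple = proj₁ (proj₂ (proj₂ (Normal-++⁻ʳ xs normal)))
  y-gcd : IsLGcd n y (Δ n) (y ++ Δ m)
  y-gcd = IsLGcd-resp-≈ ≈-refl ≈-refl (concat-pair y (Δ m)) (proj₁ (proj₂ (Normal-++⁻ʳ xs normal)))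

Normal-∷ʳ-Δ⁺ : ∀ {n m} xs {y} → m ≤ n → Normal n (xs ++ [ y ]) → RDiv n (Δ m) y → Normal n (xs ++ y ∷ Δ m ∷ [])
Normal-∷ʳ-Δ⁺ {m = m} xs m≤n normal Δm≼ʳy =
  Normal-∷ʳ⁺ xs (AllP.++⁺ (proj₁ y-simple) (IsWord-mono m≤n (Δ-isWord m))) (Simple-Δ m≤n)
    (Δ≼ʳ⇒IsLGcd-Δ m≤n y-simple (RDiv⇒≼ʳ Δm≼ʳy)) normal
  where
  y-simple = proj₁ (Normal-++⁻ʳ xs normal)

-- Counting

module _ {A : Set} {_∼_ : A → A → Set} where

  IsCount-resp-⇔ : ∀ {P P′ : A → Set} {k} → (∀ {x} → P x → P′ x) → (∀ {x} → P′ x → P x) →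
                   IsCount _∼_ P k → IsCount _∼_ P′ k
  IsCount-resp-⇔ to from (f , f-P , f-injective , f-covers) = f , (λ i → to (f-P i)) , f-injective , λ a pa → f-covers a (from pa)

  module _ (∼-sym : Symmetric _∼_) where

    IsCount-⊎ : ∀ {P₁ P₂ : A → Set} {k₁ k₂} → IsCount _∼_ P₁ k₁ → IsCount _∼_ P₂ k₂ →
                (∀ {x y} → P₁ x → P₂ y → ¬ x ∼ y) → IsCount _∼_ (λ x → P₁ x ⊎ P₂ x) (k₁ + k₂)
    IsCount-⊎ {P₁} {P₂} {k₁} {k₂} (f₁ , f₁-P , f₁-inj , f₁-cov) (f₂ , f₂-P , f₂-inj , f₂-cov) disjoint =
      enum , (λ i → f-P (splitAt k₁ i)) , enum-injective , covers
      where
      f : Fin k₁ ⊎ Fin k₂ → A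
      f = [ f₁ , f₂ ]′
      enum : Fin (k₁ + k₂) → A
      enum i = f (splitAt k₁ i)
      f-P : ∀ s → P₁ (f s) ⊎ P₂ (f s)
      f-P (inj₁ i) = inj₁ (f₁-P i)
      f-P (inj₂ i) = inj₂ (f₂-P i)
      f-injective : ∀ s s′ → f s ∼ f s′ → s ≡ s′
      f-injective (inj₁ i) (inj₁ i′) e = cong inj₁ (f₁-inj i i′ e)
      f-injective (inj₁ i) (inj₂ i′) e = contradiction e (disjoint (f₁-P i) (f₂-P i′))
      f-injective (inj₂ i) (inj₁ i′) e = contradiction (∼-sym e) (disjoint (f₁-P i′) (f₂-P i))
      f-injective (inj₂ i) (inj₂ i′) e = cong inj₂ (f₂-inj i i′ e)
      enum-injective : ∀ i j → enum i ∼ enum j → i ≡ j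
      enum-injective i j e =
        trans (sym (join-splitAt k₁ k₂ i)) (trans (cong (join k₁ k₂) (f-injective (splitAt k₁ i) (splitAt k₁ j) e)) (join-splitAt k₁ k₂ j))
      covers : ∀ a → P₁ a ⊎ P₂ a → Σ (Fin (k₁ + k₂)) λ i → enum i ∼ a
      covers a (inj₁ pa) = let i , e = f₁-cov a pa in
        join k₁ k₂ (inj₁ i) , subst (λ s → f s ∼ a) (sym (splitAt-join k₁ k₂ (inj₁ i))) e
      covers a (inj₂ pa) = let i , e = f₂-cov a pa in
        join k₁ k₂ (inj₂ i) , subst (λ s → f s ∼ a) (sym (splitAt-join k₁ k₂ (inj₂ i))) e

    IsCount-Σ : ∀ s (Q : Fin s → A → Set) (c : Fin s → ℕ) → (∀ i → IsCount _∼_ (Q i) (c i)) →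
                (∀ i j {x y} → Q i x → Q j y → x ∼ y → i ≡ j) →
                IsCount _∼_ (λ x → Σ (Fin s) λ i → Q i x) (sum (tabulate c))
    IsCount-Σ zero Q c _ _ = (λ ()) , (λ ()) , (λ ()) , λ { _ (() , _) }
    IsCount-Σ (suc s) Q c counts disjoint =
      IsCount-resp-⇔ to from
        (IsCount-⊎ (counts zero)
          (IsCount-Σ s (λ i → Q (suc i)) (λ i → c (suc i)) (λ i → counts (suc i))
            (λ i j qx qy e → Fin.suc-injective (disjoint (suc i) (suc j) qx qy e)))
          (λ qx (j , qy) e → contradiction (disjoint zero (suc j) qx qy e) λ ()))
      where
      to : ∀ {x} → Q zero x ⊎ Σ (Fin s) (λ i → Q (suc i) x) → Σ (Fin (suc s)) λ i → Q i x
      to (inj₁ q) = zero , q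
      to (inj₂ (i , q)) = suc i , q
      from : ∀ {x} → Σ (Fin (suc s)) (λ i → Q i x) → Q zero x ⊎ Σ (Fin s) (λ i → Q (suc i) x)
      from (zero , q) = inj₁ q
      from (suc i , q) = inj₂ (i , q)

module _ {A : Set} {_∼_ : A → A → Set} (∼-refl : Reflexive _∼_) (∼-sym : Symmetric _∼_) (_∼?_ : ∀ x y → Dec (x ∼ y))
         {P : A → Set} (P? : ∀ x → Dec (P x)) where

  private
    Representatives : List A → Set
    Representatives xs =
      Σ (List A) λ R → All P R × AllPairs (λ x y → ¬ x ∼ y) R × (∀ {x} → x ∈ xs → P x → Any (x ∼_) R)

    representatives : ∀ xs → Representatives xs
    representatives [] = [] , [] , [] , λ ()
    representatives (x ∷ xs) with representatives xs | P? x
    ... | R , R-P , R-distinct , R-covers | no ¬px =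
      R , R-P , R-distinct , λ { (here refl) px → contradiction px ¬px ; (there y∈xs) py → R-covers y∈xs py }
    ... | R , R-P , R-distinct , R-covers | yes px with any? (x ∼?_) R
    ...   | yes x∼R = R , R-P , R-distinct , λ { (here refl) _ → x∼R ; (there y∈xs) py → R-covers y∈xs py }
    ...   | no x≁R = x ∷ R , px ∷ R-P , ¬Any⇒All¬ R x≁R ∷ R-distinct ,
                     λ { (here refl) _ → here ∼-refl ; (there y∈xs) py → there (R-covers y∈xs py) }

    lookup-injective : ∀ R → AllPairs (λ x y → ¬ x ∼ y) R → ∀ i j → lookup R i ∼ lookup R j → i ≡ j
    lookup-injective (x ∷ R) _ zero zero _ = refl
    lookup-injective (x ∷ R) (x≁R ∷ _) zero (suc j) e = contradiction e (All.lookup x≁R (∈-lookup j))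
    lookup-injective (x ∷ R) (x≁R ∷ _) (suc i) zero e = contradiction (∼-sym e) (All.lookup x≁R (∈-lookup i))
    lookup-injective (x ∷ R) (_ ∷ R-distinct) (suc i) (suc j) e = cong suc (lookup-injective R R-distinct i j e)

  IsCount-finite : (xs : List A) → (∀ {x} → P x → x ∈ xs) → Σ ℕ (IsCount _∼_ P)
  IsCount-finite xs complete with representatives xs
  ... | R , R-P , R-distinct , R-covers =
    length R , lookup R , (λ i → All.lookup R-P (∈-lookup i)) , lookup-injective R R-distinct ,
    λ a pa → let a∼R = R-covers (complete pa) pa in index a∼R , ∼-sym (lookup-index a∼R)

module _ {A : Set} {_∼_ : A → A → Set} (∼-refl : Reflexive _∼_) (∼-sym : Symmetric _∼_) (∼-trans : Transitive _∼_) where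

  Pointwise-∷ʳ⁻ : ∀ {e} (w w′ : Vec A e) {y y′} → Pointwise _∼_ (w ∷ʳ y) (w′ ∷ʳ y′) → Pointwise _∼_ w w′ × y ∼ y′
  Pointwise-∷ʳ⁻ [] [] (y∼ ∷ []) = [] , y∼
  Pointwise-∷ʳ⁻ (x ∷ w) (x′ ∷ w′) (x∼ ∷ rest) = let w∼ , y∼ = Pointwise-∷ʳ⁻ w w′ rest in x∼ ∷ w∼ , y∼

  Pointwise-∷ʳ⁺ : ∀ {e} {w w′ : Vec A e} {y y′} → Pointwise _∼_ w w′ → y ∼ y′ → Pointwise _∼_ (w ∷ʳ y) (w′ ∷ʳ y′)
  Pointwise-∷ʳ⁺ [] y∼ = y∼ ∷ []
  Pointwise-∷ʳ⁺ (x∼ ∷ w∼) y∼ = x∼ ∷ Pointwise-∷ʳ⁺ w∼ y∼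

  -- The P-sequences are partitioned by the ∼-class of their last entry.
  IsCount-∷ʳ : ∀ {e} {P : Vec A (suc e) → Set} {Q : Vec A e → A → Set} {R : A → Set} {s f} {c : Fin s → ℕ} →
               (∀ {w y} → P (w ∷ʳ y) → Q w y × R y) → (∀ {w y} → Q w y → R y → P (w ∷ʳ y)) →
               (∀ {w y y′} → y ∼ y′ → Q w y → Q w y′) →
               IsEnum _∼_ R s f → (∀ i → IsCount (Pointwise _∼_) (λ w → Q w (f i)) (c i)) →
               IsCount (Pointwise _∼_) P (sum (tabulate c))
  IsCount-∷ʳ {e} {P} {Q} {R} {s} {f} {c} split join Q-resp (f-R , f-injective , f-covers) counts =
    IsCount-resp-⇔ {_∼_ = Pointwise _∼_} (λ (_ , p , _) → p) toBlock
      (IsCount-Σ (Pointwise-sym) s Block c blockCount blocks-disjoint)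
    where
    Pointwise-sym : Symmetric (Pointwise _∼_ {suc e})
    Pointwise-sym = PW.sym ∼-sym
    Block : Fin s → Vec A (suc e) → Set
    Block i v = P v × Σ (Vec A e) λ w → Pointwise _∼_ v (w ∷ʳ f i)

    toBlock : ∀ {v} → P v → Σ (Fin s) λ i → Block i v
    toBlock {v} pv with initLastᵛ v
    ... | w , y , refl = let i , fi∼y = f-covers y (proj₂ (split pv)) in
      i , pv , w , Pointwise-∷ʳ⁺ (PW.refl ∼-refl) (∼-sym fi∼y)

    blocks-disjoint : ∀ i j {v v′} → Block i v → Block j v′ → Pointwise _∼_ v v′ → i ≡ j
    blocks-disjoint i j (_ , w , v∼) (_ , w′ , v′∼) v∼v′ =
      f-injective i j (proj₂ (Pointwise-∷ʳ⁻ w w′ (PW.trans ∼-trans (PW.sym ∼-sym v∼) (PW.trans ∼-trans v∼v′ v′∼))))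

    blockCount : ∀ i → IsCount (Pointwise _∼_) (Block i) (c i)
    blockCount i = let g , g-Q , g-injective , g-covers = counts i in
      (λ j → g j ∷ʳ f i) ,
      (λ j → join (g-Q j) (f-R i) , g j , PW.refl ∼-refl) ,
      (λ j j′ gj∼ → g-injective j j′ (proj₁ (Pointwise-∷ʳ⁻ (g j) (g j′) gj∼))) ,
      covers g g-covers
      where
      covers : (g : Fin (c i) → Vec A e) → (∀ w → Q w (f i) → Σ (Fin (c i)) λ j → Pointwise _∼_ (g j) w) →
               ∀ v → Block i v → Σ (Fin (c i)) λ j → Pointwise _∼_ (g j ∷ʳ f i) v
      covers g g-covers v (pv , w , v∼) with initLastᵛ v
      ... | w₀ , y , refl =
        let y∼fi = proj₂ (Pointwise-∷ʳ⁻ w₀ w v∼)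
            j , gj∼w₀ = g-covers w₀ (Q-resp y∼fi (proj₁ (split pv)))
        in j , Pointwise-∷ʳ⁺ gj∼w₀ (∼-sym y∼fi)

-- Finite enumerations and decidability

wordsOfLength : ℕ → ℕ → List BWord
wordsOfLength k zero = [ [] ]
wordsOfLength k (suc L) = concatMap (λ i → map (i ∷_) (wordsOfLength k L)) (upTo k)

∈-wordsOfLength : ∀ {k} w → All (_< k) w → w ∈ wordsOfLength k (length w)
∈-wordsOfLength [] [] = here refl
∈-wordsOfLength {k} (i ∷ w) (i<k ∷ w<k) =
  ∈-concatMap⁺ (λ j → map (j ∷_) (wordsOfLength k (length w)))
    (Any.map (λ { refl → ∈-map⁺ (i ∷_) (∈-wordsOfLength w w<k) }) (∈-upTo⁺ i<k))

wordsUpTo : ℕ → ℕ → List BWord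
wordsUpTo k L = concatMap (wordsOfLength k) (upTo (suc L))

∈-wordsUpTo : ∀ {k L} w → All (_< k) w → length w ≤ L → w ∈ wordsUpTo k L
∈-wordsUpTo {k} w w<k w≤L = ∈-concatMap⁺ (wordsOfLength k) (Any.map (λ { refl → ∈-wordsOfLength w w<k }) (∈-upTo⁺ (s≤s w≤L)))

IsWord⇒All< : ∀ {n w} → IsWord n w → All (_< n) w
IsWord⇒All< = All.map (≤-trans (n≤1+n _))

LDiv⇒length≤ : ∀ {n c a} → LDiv n c a → length c ≤ length a
LDiv⇒length≤ {c = c} (z , _ , cz≈a) =
  ≤-trans (m≤m+n (length c) (length z)) (≤-reflexive (trans (sym (length-++ c)) (≈⇒length≡ cz≈a)))

Simple∈wordsUpTo : ∀ {n y} → Simple n y → y ∈ wordsUpTo n (length (Δ n))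
Simple∈wordsUpTo {y = y} (y-word , y≼Δ) = ∈-wordsUpTo y (IsWord⇒All< y-word) (LDiv⇒length≤ y≼Δ)

vectorsOver : ∀ {A : Set} e → List A → List (Vec A e)
vectorsOver zero xs = [ [] ]
vectorsOver (suc e) xs = concatMap (λ x → map (x ∷_) (vectorsOver e xs)) xs

∈-vectorsOver : ∀ {A : Set} {e xs} (v : Vec A e) → Vec.All (_∈ xs) v → v ∈ vectorsOver e xs
∈-vectorsOver [] Vec.[] = here refl
∈-vectorsOver {e = suc e} {xs} (x ∷ v) (x∈xs Vec.∷ v∈xs) =
  ∈-concatMap⁺ (λ y → map (y ∷_) (vectorsOver e xs)) (Any.map (λ { refl → ∈-map⁺ (x ∷_) (∈-vectorsOver v v∈xs) }) x∈xs)

Simple? : ∀ n x → Dec (Simple n x)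
Simple? n x = IsWord? n x ×-dec LDiv? n x (Δ n)

-- a common divisor c of a and b is no longer than a, so the gcd condition is a finite check
IsLGcd? : ∀ n g a b → Dec (IsLGcd n g a b)
IsLGcd? n g a b = LDiv? n g a ×-dec (LDiv? n g b ×-dec greatest?)
  where
  Greatest : BWord → Set
  Greatest c = IsWord n c → LDiv n c a → LDiv n c b → LDiv n c g
  greatest? : Dec (∀ c → Greatest c)
  greatest? with all? (λ c → IsWord? n c →-dec (LDiv? n c a →-dec (LDiv? n c b →-dec LDiv? n c g))) (wordsUpTo n (length a))
  ... | yes all-greatest = yes λ c c-word c≼a →
        All.lookup all-greatest (∈-wordsUpTo c (IsWord⇒All< c-word) (LDiv⇒length≤ c≼a)) c-word c≼a
  ... | no ¬all-greatest = no λ greatest → ¬all-greatest (All.tabulate λ {c} _ → greatest c)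

Normal? : ∀ n zs → Dec (Normal n zs)
Normal? n [] = yes tt
Normal? n (x ∷ zs) = Simple? n x ×-dec (IsLGcd? n x (Δ n) (concat (x ∷ zs)) ×-dec Normal? n zs)

Normal⇒All-Simple : ∀ {n e} (xs : Vec BWord e) {ys} → Normal n (toList xs ++ ys) → Vec.All (Simple n) xs
Normal⇒All-Simple [] _ = Vec.[]
Normal⇒All-Simple (x ∷ xs) (x-simple , _ , rest) = x-simple Vec.∷ Normal⇒All-Simple xs rest

Normal-∷ʳ-resp-≈ : ∀ {n} xs {y y′} → y ≈ y′ → Normal n (xs ++ [ y ]) → Normal n (xs ++ [ y′ ])
Normal-∷ʳ-resp-≈ [] y≈ (y-simple , _ , _) = Simple-resp-≈ y≈ y-simple , Simple⇒IsLGcd-self (Simple-resp-≈ y≈ y-simple) , tt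
Normal-∷ʳ-resp-≈ (x ∷ xs) {y} {y′} y≈ (x-simple , x-gcd , rest) =
  x-simple ,
  IsLGcd-resp-≈ ≈-refl ≈-refl
    (concat-∷-++ x xs [ y ] ⨾ ++⁺ˡ (x ++ concat xs) (++⁺ʳ [] y≈) ⨾ ≈-sym (concat-∷-++ x xs [ y′ ])) x-gcd ,
  Normal-∷ʳ-resp-≈ xs y≈ rest

BCount-exists : ∀ n e y → Σ ℕ (BCount n (suc e) y)
BCount-exists n e y =
  IsCount-finite (PW.refl ≈-refl) (PW.sym ≈-sym) (PW.decidable _≈?_) (λ w → Normal? n (toList w ++ [ y ]))
    (vectorsOver e (wordsUpTo n (length (Δ n))))
    (λ {w} normal → ∈-vectorsOver w (Vec.map Simple∈wordsUpTo (Normal⇒All-Simple w normal)))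

simpleClasses : ∀ n {Q : BWord → Set} → (∀ x → Dec (Q x)) → Σ ℕ (IsCount _≈_ (λ x → Simple n x × Q x))
simpleClasses n Q? =
  IsCount-finite ≈-refl ≈-sym _≈?_ (λ x → Simple? n x ×-dec Q? x) (wordsUpTo n (length (Δ n)))
    (λ (x-simple , _) → Simple∈wordsUpTo x-simple)

toList-∷ʳ-++ : ∀ {e} (w : Vec BWord e) y z → toList (w ∷ʳ y) ++ [ z ] ≡ toList w ++ y ∷ z ∷ []
toList-∷ʳ-++ w y z = trans (cong (_++ [ z ]) (toList-∷ʳ y w)) (++-assoc (toList w) [ y ] [ z ])

module _ {n m : ℕ} (m≤n : m ≤ n) {e} {w : Vec BWord e} {y : BWord} where

  Normal-∷ʳ-Δ-split : Normal n (toList (w ∷ʳ y) ++ [ Δ m ]) → Normal n (toList w ++ [ y ]) × (Simple n y × RDiv n (Δ m) y)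
  Normal-∷ʳ-Δ-split normal =
    let w-normal , Δm≼ʳy = Normal-∷ʳ-Δ⁻ (toList w) m≤n (subst (Normal n) (toList-∷ʳ-++ w y (Δ m)) normal)
    in w-normal , proj₁ (Normal-++⁻ʳ (toList w) w-normal) , Δm≼ʳy

  Normal-∷ʳ-Δ-join : Normal n (toList w ++ [ y ]) → Simple n y × RDiv n (Δ m) y → Normal n (toList (w ∷ʳ y) ++ [ Δ m ])
  Normal-∷ʳ-Δ-join w-normal (_ , Δm≼ʳy) =
    subst (Normal n) (sym (toList-∷ʳ-++ w y (Δ m))) (Normal-∷ʳ-Δ⁺ (toList w) m≤n w-normal Δm≼ʳy)

lemma4p3 : ∀ (n r d : ℕ) → 1 ≤ r → r ≤ n → 2 ≤ d →
    Σ ℕ λ k → BCount n d (Δ (n ∸ r)) k ×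
      Σ ℕ λ s → Σ (Fin s → List ℕ) λ f →
        IsEnum _≈_ (λ x → Simple n x × RDiv n (Δ (n ∸ r)) x) s f ×
        Σ (Fin s → ℕ) λ c →
          (∀ i → BCount n (d ∸ 1) (f i) (c i)) × k ≡ sum (tabulate c)
lemma4p3 n r (suc (suc e)) _ _ _ =
  sum (tabulate c) ,
  IsCount-∷ʳ ≈-refl ≈-sym ≈-trans (Normal-∷ʳ-Δ-split m≤n) (Normal-∷ʳ-Δ-join m≤n) (λ {w} → Normal-∷ʳ-resp-≈ (toList w))
    f-enum counts ,
  s , f , f-enum , c , counts , refl
  where
  m≤n = m∸n≤m n r
  classes = simpleClasses n (RDiv? n (Δ (n ∸ r)))
  s = proj₁ classes
  f = proj₁ (proj₂ classes)
  f-enum = proj₂ (proj₂ classes)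
  c : Fin s → ℕ
  c i = proj₁ (BCount-exists n e (f i))
  counts : ∀ i → BCount n (suc e) (f i) (c i)
  counts i = proj₂ (BCount-exists n e (f i))
lemma4p3 n r (suc zero) _ _ (s≤s ())
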